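{- Let $H$ be a simple hypergraph with $e$-index $k$, and let $\nu_1(H)\ge\cdots\ge\nu_k(H)$ be the eigenvalues of its unified Laplacian matrix. Then $\nu_{k-1}(H)\ne 0$ if and only if $H$ is deeply connected.
   Context: A hypergraph $H$ consists of a nonempty finite vertex set $V(H)$ and a finite multiset $E(H)$ of nonempty subsets of $V(H)$ (edges); $H$ is simple if it has no edges of cardinality $1$ and no repeated edges. A 2-partition of a set $e$ is an unordered pair $\{S_1,S_2\}$ of nonempty disjoint sets with union $e$. $I(H)$ is the set of all parts of all 2-partitions of all edges of $H$, together with all singletons $\{v\}$, $v\in V(H)$; $k=|I(H)|$. For $S,S'\in I(H)$ write $S\sim S'$ if $\{S,S'\}$ is a 2-partition of some edge. For simple $H$, $d^*_H(S)$ is the number of $S'\in I(H)$ with $S\sim S'$; the unified Laplacian matrix $\mathbf U^{\mathbf L}(H)$ is indexed by $I(H)$ with diagonal entries $d^*_H(S)$, $(S,S')$ entry $-1$ if $S\sim S'$, and $0$ otherwise. An exact path is a sequence $S_0,e_1,S_1,\dots,e_n,S_n$ with $e_i\in E(H)$, $\{S_{i-1},S_i\}$ a 2-partition of $e_i$, and $S_0,\dots,S_n$ distinct; it joins $S_0$ and $S_n$. $H$ is deeply connected if every two distinct elements of $I(H)$ are joined by an exact path. -}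

module Defs where

open import Level using (Level; _⊔_) renaming (suc to lsuc)
open import Data.Nat using (ℕ; zero; suc; _≤_; s≤s)
open import Data.Bool using (Bool; true; false)
import Data.Bool.Properties as BoolP
open import Data.Fin using (Fin; zero; suc; punchIn; inject₁; fromℕ) renaming (_≤_ to _≤ᶠ_)
open import Data.Fin.Subset using (Subset; _∪_; _∩_; ⊥; ⁅_⁆; Nonempty; ∣_∣; inside; outside)
open import Data.Fin.Subset.Properties using (nonempty?; anySubset?)
import Data.Fin.Properties as FinP
open import Data.Vec using (Vec; []; _∷_)
import Data.Vec.Properties as VecP
open import Data.List using (List; []; _∷_; _++_; map; filter; length; lookup; allFin)
open import Data.List.Relation.Unary.Any using (Any; any?)
open import Data.List.Relation.Unary.All using (All)
open import Data.List.Relation.Unary.Unique.Propositional using (Unique)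
open import Data.Product using (Σ; ∃; ∃-syntax; _×_; _,_)
open import Data.Sum using (_⊎_)
open import Function using (_∘_; _⇔_)
open import Function.Definitions using (Injective)
open import Relation.Nullary using (¬_; Dec; yes; no)
open import Relation.Nullary.Decidable using (_×-dec_; _⊎-dec_)
open import Relation.Binary.PropositionalEquality using (_≡_; _≢_)
open import Relation.Binary using (Rel; IsTotalOrder; DecidableEquality)
open import Algebra.Bundles using (CommutativeRing)

-- Hypergraphs on the vertex set Fin n (n ≥ 1); edges form a multiset,
-- represented as a list of subsets of Fin n.

record Hypergraph : Set where
  field
    n          : ℕ
    n-pos      : 1 ≤ n
    edges      : List (Subset n)
    edges-nonempty : All Nonempty edges

open Hypergraph public

IsSimple : Hypergraph → Set
IsSimple H = All (λ e → ∣ e ∣ ≢ 1) (edges H) × Unique (edges H)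

_≟ˢ_ : ∀ {m} → DecidableEquality (Subset m)
_≟ˢ_ = VecP.≡-dec BoolP._≟_

Sim : (H : Hypergraph) → Subset (n H) → Subset (n H) → Set
Sim H S S' = Any (λ e → S ∪ S' ≡ e) (edges H) × (S ∩ S' ≡ ⊥) × Nonempty S × Nonempty S'

∼-dec : (H : Hypergraph) (S S' : Subset (n H)) → Dec (Sim H S S')
∼-dec H S S' = any? (λ e → (S ∪ S') ≟ˢ e) (edges H) ×-dec ((S ∩ S') ≟ˢ ⊥)
               ×-dec nonempty? S ×-dec nonempty? S'

allSubsets : ∀ m → List (Subset m)
allSubsets zero    = [] ∷ []
allSubsets (suc m) = map (inside ∷_) (allSubsets m) ++ map (outside ∷_) (allSubsets m)

InI : (H : Hypergraph) → Subset (n H) → Set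
InI H S = (∃[ v ] S ≡ ⁅ v ⁆) ⊎ (∃[ S' ] Sim H S S')

InI-dec : (H : Hypergraph) (S : Subset (n H)) → Dec (InI H S)
InI-dec H S = singleton? ⊎-dec partner?
  where
  singleton? : Dec (∃[ v ] S ≡ ⁅ v ⁆)
  singleton? = FinP.any? (λ v → S ≟ˢ ⁅ v ⁆)
  partner? : Dec (∃[ S' ] Sim H S S')
  partner? = anySubset? (∼-dec H S)

-- I(H) as an explicit duplicate-free list, its size k = |I(H)|, and the
-- indexing of I(H) by Fin k used for the rows/columns of the matrix
Ilist : (H : Hypergraph) → List (Subset (n H))
Ilist H = filter (InI-dec H) (allSubsets (n H))

eIndex : Hypergraph → ℕ
eIndex H = length (Ilist H)

elemI : (H : Hypergraph) → Fin (eIndex H) → Subset (n H)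
elemI H = lookup (Ilist H)

dstar : (H : Hypergraph) → Subset (n H) → ℕ
dstar H S = length (filter (∼-dec H S) (Ilist H))

record OrderedField (c ℓ₁ ℓ₂ : Level) : Set (lsuc (c ⊔ ℓ₁ ⊔ ℓ₂)) where
  field
    commutativeRing : CommutativeRing c ℓ₁
  open CommutativeRing commutativeRing public
  field
    _≤F_        : Rel Carrier ℓ₂
    isTotalOrder : IsTotalOrder _≈_ _≤F_
    0≉1         : ¬ (0# ≈ 1#)
    inverse     : ∀ x → ¬ (x ≈ 0#) → ∃[ y ] (x * y ≈ 1#)
    +-mono-≤    : ∀ {x y} z → x ≤F y → (x + z) ≤F (y + z)
    *-nonneg    : ∀ {x y} → 0# ≤F x → 0# ≤F y → 0# ≤F (x * y)

module Linear {c ℓ₁ ℓ₂} (F : OrderedField c ℓ₁ ℓ₂) where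
  open OrderedField F using (Carrier; _≈_; _+_; _*_; _-_; -_; 0#; 1#; _≤F_)

  ofℕ : ℕ → Carrier
  ofℕ zero    = 0#
  ofℕ (suc m) = 1# + ofℕ m

  altSum : ∀ {m} → (Fin m → Carrier) → Carrier
  altSum {zero}  f = 0#
  altSum {suc m} f = f zero - altSum (f ∘ suc)

  prod : ∀ {m} → (Fin m → Carrier) → Carrier
  prod {zero}  f = 1#
  prod {suc m} f = f zero * prod (f ∘ suc)

  det : ∀ {m} → (Fin m → Fin m → Carrier) → Carrier
  det {zero}  A = 1#
  det {suc m} A = altSum (λ j → A zero j * det (λ r s → A (suc r) (punchIn j s)))

  UL : (H : Hypergraph) → Fin (eIndex H) → Fin (eIndex H) → Carrier
  UL H i j with i FinP.≟ j | ∼-dec H (elemI H i) (elemI H j)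
  ... | yes _ | _     = ofℕ (dstar H (elemI H i))
  ... | no _  | yes _ = - 1#
  ... | no _  | no _  = 0#

  charPoly : ∀ {m} → (Fin m → Fin m → Carrier) → Carrier → Carrier
  charPoly M x = det (λ i j → diag i j - M i j)
    where
    diag : _ → _ → Carrier
    diag i j with i FinP.≟ j
    ... | yes _ = x
    ... | no _  = 0#

  -- ν₁ ≥ … ≥ ν_m (ν (i) is ν_{i+1}) are the eigenvalues of M, listed
  -- with algebraic multiplicity in non-increasing order:
  -- det (x I - M) = ∏ (x - ν_i) (as polynomial functions on F).
  IsSortedEigenvalues : ∀ {m} → (Fin m → Fin m → Carrier) → (Fin m → Carrier) → Set _
  IsSortedEigenvalues M ν =
    (∀ x → charPoly M x ≈ prod (λ i → x - ν i)) ×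
    (∀ i j → i ≤ᶠ j → ν j ≤F ν i)

-- index of ν_{k-1} (1-based) in Fin k (0-based), i.e. the value k - 2
secondLast : ∀ {k} → 2 ≤ k → Fin k
secondLast {suc (suc m)} (s≤s (s≤s _)) = inject₁ (fromℕ m)

-- an exact path S₀ e₁ S₁ … e_m S_m is given by S : Fin (suc m) → Subset,
-- pairwise distinct, with each {S_{i-1}, S_i} a 2-partition of an edge
ExactPath : (H : Hypergraph) → Subset (n H) → Subset (n H) → Set
ExactPath H A B =
  ∃[ m ] Σ (Fin (suc m) → Subset (n H)) λ S →
    S zero ≡ A × S (fromℕ m) ≡ B × Injective _≡_ _≡_ S ×
    (∀ (i : Fin m) → Sim H (S (inject₁ i)) (S (suc i)))

DeeplyConnected : Hypergraph → Set
DeeplyConnected H = ∀ A B → InI H A → InI H B → A ≢ B → ExactPath H A B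

{-# OPTIONS --safe #-}
module Submission where

open import Algebra.Bundles using (CommutativeRing)
open import Data.Fin using (Fin)
open import Data.Nat using (suc)
open import Defs
open import Relation.Binary.Definitions using (Decidable; Symmetric)
open import Relation.Nullary using (¬_)

-- U^L(H) is the Laplacian L = D − A of the graph on I(H) whose edges are the
-- 2-partitions S ∼ S′, and exact paths are its simple walks, so deep connectivity
-- is connectivity of this graph.  The spectrum is read off the characteristic
-- polynomial p(x) = det (x I − L), without any spectral theorem:
--   * every eigenvalue is ≥ 0, by the maximum principle for an eigenvector;
--   * a vector constant on a union of components is an eigenvector of x I − L for x,
--     and factoring it out of the determinant gives p(x) = x g(x), and even
--     p(x) = x² h(x) when the graph has a cut;
--   * if the graph is connected then g(0) ≠ 0: a kernel vector of the reduced matrix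
--     yields w with L w constant, the maximum principle forces L w = 0, and harmonic
--     functions on a connected graph are constant.
-- As ν₁ ≥ … ≥ νₖ ≥ 0 are the roots of p, νₖ₋₁ ≠ 0 says exactly that 0 is a simple
-- root.  Identities x f(x) = x g(x) are cancelled at x = 0 by finite differences, and
-- case distinctions needing excluded middle are made under double negation, which
-- suffices because every conclusion drawn from them is a negation or decidable.

module IntegerSolver {c ℓ} (R : CommutativeRing c ℓ) where

  open import Algebra.Bundles using (RawRing)
  open import Data.Nat as ℕ using (ℕ; zero; suc)
  import Data.Nat.Properties as ℕ
  open import Data.Product using (_,_) renaming (_×_ to _×ₚ_)
  open import Data.Product.Properties using (≡-dec)
  open import Data.Maybe using (Maybe; just; nothing)
  open import Relation.Nullary using (yes; no)
  open import Relation.Binary.PropositionalEquality as ≡ using (_≡_)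
  open import Algebra.Solver.Ring.AlmostCommutativeRing
    using (_-Raw-AlmostCommutative⟶_; fromCommutativeRing)

  open CommutativeRing R
  open import Algebra.Properties.Ring ring using (-‿distribˡ-*; -‿distribʳ-*; -‿involutive)
  open import Algebra.Properties.AbelianGroup +-abelianGroup using (⁻¹-anti-homo‿-; ⁻¹-∙-comm; ε⁻¹≈ε)
  open import Algebra.Properties.CommutativeSemigroup +-commutativeSemigroup using (interchange)
  open import Algebra.Properties.Semiring.Mult semiring using (×-homo-+; ×1-homo-*)
    renaming (_×_ to _·_)
  open import Relation.Binary.Reasoning.Setoid setoid

  -- Algebra.Solver.Ring needs coefficients with decidable equality, which R itself
  -- need not have. Integers are encoded as differences a − b of naturals, normalised
  -- so that one side is 0; the interpretation into R is then a homomorphism without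
  -- any case analysis on signs.
  Difference : Set
  Difference = ℕ ×ₚ ℕ

  normalise : ℕ → ℕ → Difference
  normalise zero    b       = 0 , b
  normalise (suc a) zero    = suc a , 0
  normalise (suc a) (suc b) = normalise a b

  differences : RawRing _ _
  differences = record
    { Carrier = Difference
    ; _≈_     = _≡_
    ; _+_     = λ { (a , b) (c , d) → normalise (a ℕ.+ c) (b ℕ.+ d) }
    ; _*_     = λ { (a , b) (c , d) → normalise (a ℕ.* c ℕ.+ b ℕ.* d) (a ℕ.* d ℕ.+ b ℕ.* c) }
    ; -_      = λ { (a , b) → b , a }
    ; 0#      = 0 , 0
    ; 1#      = 1 , 0
    }

  ι : ℕ → Carrier
  ι n = n · 1#

  ⟦_⟧ : Difference → Carrier
  ⟦ a , b ⟧ = ι a - ι b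

  sub-+-interchange : ∀ p q r s → (p + q) - (r + s) ≈ (p - r) + (q - s)
  sub-+-interchange p q r s = begin
    (p + q) - (r + s)     ≈⟨ +-congˡ (⁻¹-∙-comm r s) ⟨
    (p + q) + (- r + - s) ≈⟨ interchange p q (- r) (- s) ⟩
    (p - r) + (q - s)     ∎

  sub-*-expand : ∀ p q r s → (p * q + r * s) - (p * s + r * q) ≈ (p - r) * (q - s)
  sub-*-expand p q r s = begin
    (p * q + r * s) - (p * s + r * q)           ≈⟨ +-congˡ (⁻¹-∙-comm _ _) ⟨
    (p * q + r * s) + (- (p * s) + - (r * q))   ≈⟨ interchange _ _ _ _ ⟩
    (p * q - p * s) + (r * s - r * q)           ≈⟨ +-congˡ (+-comm _ _) ⟩
    (p * q - p * s) + (- (r * q) + r * s)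
      ≈⟨ +-cong (+-congˡ (-‿distribʳ-* p s)) (+-cong (-‿distribˡ-* r q) -r*-s≈r*s) ⟩
    (p * q + p * - s) + (- r * q + - r * - s)   ≈⟨ +-cong (distribˡ p q (- s)) (distribˡ (- r) q (- s)) ⟨
    p * (q - s) + - r * (q - s)                 ≈⟨ distribʳ (q - s) p (- r) ⟨
    (p - r) * (q - s)                           ∎
    where
    -r*-s≈r*s : r * s ≈ - r * - s
    -r*-s≈r*s = begin
      r * s       ≈⟨ -‿involutive _ ⟨
      - - (r * s) ≈⟨ -‿cong (-‿distribʳ-* r s) ⟩
      - (r * - s) ≈⟨ -‿distribˡ-* r (- s) ⟩
      - r * - s   ∎

  ⟦normalise⟧ : ∀ a b → ⟦ normalise a b ⟧ ≈ ι a - ι b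
  ⟦normalise⟧ zero    b       = refl
  ⟦normalise⟧ (suc a) zero    = refl
  ⟦normalise⟧ (suc a) (suc b) = begin
    ⟦ normalise a b ⟧       ≈⟨ ⟦normalise⟧ a b ⟩
    ι a - ι b               ≈⟨ +-identityˡ _ ⟨
    0# + (ι a - ι b)        ≈⟨ +-congʳ (-‿inverseʳ 1#) ⟨
    (1# - 1#) + (ι a - ι b) ≈⟨ sub-+-interchange 1# (ι a) 1# (ι b) ⟨
    ι (suc a) - ι (suc b)   ∎

  ⟦⟧-homomorphism : differences -Raw-AlmostCommutative⟶ fromCommutativeRing R
  ⟦⟧-homomorphism = record
    { ⟦_⟧    = ⟦_⟧
    ; +-homo = λ { (a , b) (c , d) → begin
        ⟦ normalise (a ℕ.+ c) (b ℕ.+ d) ⟧ ≈⟨ ⟦normalise⟧ (a ℕ.+ c) (b ℕ.+ d) ⟩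
        ι (a ℕ.+ c) - ι (b ℕ.+ d)         ≈⟨ +-cong (×-homo-+ 1# a c) (-‿cong (×-homo-+ 1# b d)) ⟩
        (ι a + ι c) - (ι b + ι d)         ≈⟨ sub-+-interchange _ _ _ _ ⟩
        ⟦ a , b ⟧ + ⟦ c , d ⟧             ∎ }
    ; *-homo = λ { (a , b) (c , d) → begin
        ⟦ normalise (a ℕ.* c ℕ.+ b ℕ.* d) (a ℕ.* d ℕ.+ b ℕ.* c) ⟧
          ≈⟨ ⟦normalise⟧ (a ℕ.* c ℕ.+ b ℕ.* d) (a ℕ.* d ℕ.+ b ℕ.* c) ⟩
        ι (a ℕ.* c ℕ.+ b ℕ.* d) - ι (a ℕ.* d ℕ.+ b ℕ.* c)
          ≈⟨ +-cong (ι-+-* a c b d) (-‿cong (ι-+-* a d b c)) ⟩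
        (ι a * ι c + ι b * ι d) - (ι a * ι d + ι b * ι c)
          ≈⟨ sub-*-expand _ _ _ _ ⟩
        ⟦ a , b ⟧ * ⟦ c , d ⟧ ∎ }
    ; -‿homo = λ { (a , b) → sym (⁻¹-anti-homo‿- (ι a) (ι b)) }
    ; 0-homo = -‿inverseʳ 0#
    ; 1-homo = trans (+-congˡ ε⁻¹≈ε) (trans (+-identityʳ _) (+-identityʳ 1#))
    }
    where
    ι-+-* : ∀ a c b d → ι (a ℕ.* c ℕ.+ b ℕ.* d) ≈ ι a * ι c + ι b * ι d
    ι-+-* a c b d = trans (×-homo-+ 1# (a ℕ.* c) (b ℕ.* d)) (+-cong (×1-homo-* a c) (×1-homo-* b d))

  _≟-coefficient_ : ∀ x y → Maybe (⟦ x ⟧ ≈ ⟦ y ⟧)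
  x ≟-coefficient y with ≡-dec ℕ._≟_ ℕ._≟_ x y
  ... | yes ≡.refl = just refl
  ... | no _       = nothing

  open import Algebra.Solver.Ring differences (fromCommutativeRing R) ⟦⟧-homomorphism _≟-coefficient_ public
    using (solve; _:=_; _:+_; _:*_; _:-_; :-_)

module OrderedFieldProperties {c ℓ₁ ℓ₂} (F : OrderedField c ℓ₁ ℓ₂) where

  open import Data.Nat using (zero; suc)
  open import Data.Fin using (Fin; zero; suc; punchIn)
  open import Data.Fin.Properties using (punchInᵢ≢i; ∀-cons)
  open import Data.Product using (∃; _,_)
  open import Data.Sum using (inj₁; inj₂)
  open import Function using (_∘_)
  open import Relation.Binary.PropositionalEquality using (_≢_)
  open import Relation.Binary.Structures using (IsTotalOrder)
  open import Relation.Nullary using (¬_; Dec; yes; no; contradiction)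

  open OrderedField F public hiding (zero) renaming (+-mono-≤ to +-monoˡ-≤)
  open IntegerSolver commutativeRing public using (solve; _:=_; _:+_; _:*_; _:-_; :-_)
  open import Algebra.Properties.Ring ring public using (-‿distribˡ-*; -‿distribʳ-*; -‿involutive)
  open import Algebra.Properties.AbelianGroup +-abelianGroup public using (ε⁻¹≈ε; ⁻¹-∙-comm)
  open import Algebra.Properties.Semiring.Sum semiring public
    using (sum; sum-cong-≋; sum-remove; ∑-distrib-+; *-distribˡ-sum; *-distribʳ-sum; sum-replicate-zero)
  open import Relation.Binary.Reasoning.Setoid setoid public

  -- _≤F_ comes without a fixity declaration.
  infix 4 _≤_
  _≤_ : Carrier → Carrier → Set ℓ₂
  x ≤ y = x ≤F y

  open IsTotalOrder isTotalOrder public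
    using ()
    renaming ( refl to ≤-refl; reflexive to ≤-reflexive; trans to ≤-trans; antisym to ≤-antisym
             ; total to ≤-total; ≲-respˡ-≈ to ≤-respˡ-≈; ≲-respʳ-≈ to ≤-respʳ-≈ )

  ≤-resp-≈ : ∀ {x x′ y y′} → x ≈ x′ → y ≈ y′ → x ≤ y → x′ ≤ y′
  ≤-resp-≈ x≈x′ y≈y′ = ≤-respˡ-≈ x≈x′ ∘ ≤-respʳ-≈ y≈y′

  +-monoʳ-≤ : ∀ {x y} z → x ≤ y → z + x ≤ z + y
  +-monoʳ-≤ {x} {y} z x≤y = ≤-resp-≈ (+-comm x z) (+-comm y z) (+-monoˡ-≤ z x≤y)

  +-mono-≤ : ∀ {x y u v} → x ≤ y → u ≤ v → x + u ≤ y + v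
  +-mono-≤ {y = y} {u} x≤y u≤v = ≤-trans (+-monoˡ-≤ u x≤y) (+-monoʳ-≤ y u≤v)

  x≤y⇒0≤y-x : ∀ {x y} → x ≤ y → 0# ≤ y - x
  x≤y⇒0≤y-x {x} x≤y = ≤-respˡ-≈ (-‿inverseʳ x) (+-monoˡ-≤ (- x) x≤y)

  0≤y-x⇒x≤y : ∀ {x y} → 0# ≤ y - x → x ≤ y
  0≤y-x⇒x≤y {x} {y} 0≤y-x =
    ≤-resp-≈ (+-identityˡ x) (solve 2 (λ x y → y :- x :+ x := y) refl x y) (+-monoˡ-≤ x 0≤y-x)

  0≤x⇒-x≤0 : ∀ {x} → 0# ≤ x → - x ≤ 0#
  0≤x⇒-x≤0 {x} 0≤x = ≤-resp-≈ (+-identityˡ (- x)) (-‿inverseʳ x) (+-monoˡ-≤ (- x) 0≤x)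

  x≤0⇒0≤-x : ∀ {x} → x ≤ 0# → 0# ≤ - x
  x≤0⇒0≤-x {x} x≤0 = ≤-resp-≈ (-‿inverseʳ x) (+-identityˡ (- x)) (+-monoˡ-≤ (- x) x≤0)

  -x*-y≈x*y : ∀ x y → - x * - y ≈ x * y
  -x*-y≈x*y x y = begin
    - x * - y   ≈⟨ -‿distribˡ-* x (- y) ⟨
    - (x * - y) ≈⟨ -‿cong (-‿distribʳ-* x y) ⟨
    - - (x * y) ≈⟨ -‿involutive _ ⟩
    x * y       ∎

  0≤1 : 0# ≤ 1#
  0≤1 with ≤-total 0# 1#
  ... | inj₁ 0≤1 = 0≤1
  ... | inj₂ 1≤0 = contradiction (≤-antisym 0≤1′ 1≤0) 0≉1
    where
    0≤1′ : 0# ≤ 1#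
    0≤1′ = ≤-respʳ-≈ (trans (-x*-y≈x*y 1# 1#) (*-identityˡ 1#))
             (*-nonneg (x≤0⇒0≤-x 1≤0) (x≤0⇒0≤-x 1≤0))

  1+1≉0 : ¬ (1# + 1# ≈ 0#)
  1+1≉0 1+1≈0 = 0≉1 (≤-antisym 0≤1 1≤0)
    where
    1≤0 : 1# ≤ 0#
    1≤0 = ≤-resp-≈ (+-identityʳ 1#) 1+1≈0 (+-monoʳ-≤ 1# 0≤1)

  *-monoˡ-≤-nonNeg : ∀ {x y} z → 0# ≤ z → x ≤ y → x * z ≤ y * z
  *-monoˡ-≤-nonNeg {x} {y} z 0≤z x≤y = 0≤y-x⇒x≤y (≤-respʳ-≈ expand (*-nonneg (x≤y⇒0≤y-x x≤y) 0≤z))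
    where
    expand : (y - x) * z ≈ y * z - x * z
    expand = solve 3 (λ x y z → (y :- x) :* z := y :* z :- x :* z) refl x y z

  *-cancelˡ : ∀ {x y z} → x ≉ 0# → x * y ≈ x * z → y ≈ z
  *-cancelˡ {x} {y} {z} x≉0 xy≈xz with inverse x x≉0
  ... | x⁻¹ , x*x⁻¹≈1 = begin
    y             ≈⟨ *-identityˡ y ⟨
    1# * y        ≈⟨ *-congʳ x*x⁻¹≈1 ⟨
    x * x⁻¹ * y   ≈⟨ solve 3 (λ x i y → x :* i :* y := i :* (x :* y)) refl x x⁻¹ y ⟩
    x⁻¹ * (x * y) ≈⟨ *-congˡ xy≈xz ⟩
    x⁻¹ * (x * z) ≈⟨ solve 3 (λ x i z → i :* (x :* z) := x :* i :* z) refl x x⁻¹ z ⟩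
    x * x⁻¹ * z   ≈⟨ *-congʳ x*x⁻¹≈1 ⟩
    1# * z        ≈⟨ *-identityˡ z ⟩
    z             ∎

  x*y≈0⇒y≈0 : ∀ {x y} → x ≉ 0# → x * y ≈ 0# → y ≈ 0#
  x*y≈0⇒y≈0 {x} x≉0 xy≈0 = *-cancelˡ x≉0 (trans xy≈0 (sym (zeroʳ x)))

  x≉0∧y≉0⇒x*y≉0 : ∀ {x y} → x ≉ 0# → y ≉ 0# → x * y ≉ 0#
  x≉0∧y≉0⇒x*y≉0 x≉0 y≉0 = y≉0 ∘ x*y≈0⇒y≈0 x≉0

  x-y≈0⇒x≈y : ∀ {x y} → x - y ≈ 0# → x ≈ y
  x-y≈0⇒x≈y {x} {y} x-y≈0 = begin
    x           ≈⟨ solve 2 (λ x y → x := (x :- y) :+ y) refl x y ⟩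
    (x - y) + y ≈⟨ +-congʳ x-y≈0 ⟩
    0# + y      ≈⟨ +-identityˡ y ⟩
    y           ∎

  y≈0⇒x+y≈x : ∀ {x y} → y ≈ 0# → x + y ≈ x
  y≈0⇒x+y≈x {x} y≈0 = trans (+-congˡ y≈0) (+-identityʳ x)

  y≈0⇒x-y≈x : ∀ x {y} → y ≈ 0# → x - y ≈ x
  y≈0⇒x-y≈x x y≈0 = trans (+-congˡ (trans (-‿cong y≈0) ε⁻¹≈ε)) (+-identityʳ x)

  x≈-x⇒x≈0 : ∀ {x} → x ≈ - x → x ≈ 0#
  x≈-x⇒x≈0 {x} x≈-x = x*y≈0⇒y≈0 1+1≉0 (begin
    (1# + 1#) * x   ≈⟨ distribʳ x 1# 1# ⟩
    1# * x + 1# * x ≈⟨ +-cong (*-identityˡ x) (*-identityˡ x) ⟩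
    x + x           ≈⟨ +-congˡ x≈-x ⟩
    x - x           ≈⟨ -‿inverseʳ x ⟩
    0#              ∎)

  argmax : ∀ {m} (v : Fin (suc m) → Carrier) → ∃ λ a → ∀ l → v l ≤ v a
  argmax {zero}  v = zero , λ { zero → ≤-refl }
  argmax {suc m} v with argmax (v ∘ suc)
  ... | a , max with ≤-total (v zero) (v (suc a))
  ...   | inj₁ v₀≤vₐ = suc a , λ { zero → v₀≤vₐ ; (suc l) → max l }
  ...   | inj₂ vₐ≤v₀ = zero , λ { zero → ≤-refl ; (suc l) → ≤-trans (max l) vₐ≤v₀ }

  argmin : ∀ {m} (v : Fin (suc m) → Carrier) → ∃ λ b → ∀ l → v b ≤ v l
  argmin {zero}  v = zero , λ { zero → ≤-refl }
  argmin {suc m} v with argmin (v ∘ suc)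
  ... | b , min with ≤-total (v zero) (v (suc b))
  ...   | inj₁ v₀≤v_b = zero , λ { zero → ≤-refl ; (suc l) → ≤-trans v₀≤v_b (min l) }
  ...   | inj₂ v_b≤v₀ = suc b , λ { zero → v_b≤v₀ ; (suc l) → min l }

  sum-zero : ∀ {m} {f : Fin m → Carrier} → (∀ i → f i ≈ 0#) → sum f ≈ 0#
  sum-zero {m} f≈0 = trans (sum-cong-≋ f≈0) (sum-replicate-zero m)

  sum-δ : ∀ {m} (q : Fin m) {f : Fin m → Carrier} → (∀ j → j ≢ q → f j ≈ 0#) → sum f ≈ f q
  sum-δ {suc m} q {f} f≈0 = begin
    sum f                     ≈⟨ sum-remove f ⟩
    f q + sum (f ∘ punchIn q) ≈⟨ +-congˡ (sum-zero (λ j → f≈0 (punchIn q j) (punchInᵢ≢i q j))) ⟩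
    f q + 0#                  ≈⟨ +-identityʳ (f q) ⟩
    f q                       ∎

  sum-neg : ∀ {m} (f : Fin m → Carrier) → sum (λ i → - f i) ≈ - sum f
  sum-neg {zero}  f = sym ε⁻¹≈ε
  sum-neg {suc m} f = trans (+-congˡ (sum-neg (f ∘ suc))) (⁻¹-∙-comm _ _)

  sum-sub : ∀ {m} (f g : Fin m → Carrier) → sum (λ i → f i - g i) ≈ sum f - sum g
  sum-sub f g = trans (∑-distrib-+ f (λ i → - g i)) (+-congˡ (sum-neg g))

  sum-nonNeg : ∀ {m} {f : Fin m → Carrier} → (∀ i → 0# ≤ f i) → 0# ≤ sum f
  sum-nonNeg {zero}  0≤f = ≤-refl
  sum-nonNeg {suc m} 0≤f = ≤-respˡ-≈ (+-identityʳ 0#) (+-mono-≤ (0≤f zero) (sum-nonNeg (0≤f ∘ suc)))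

  sum-nonNeg≈0⇒≈0 : ∀ {m} {f : Fin m → Carrier} → (∀ i → 0# ≤ f i) → sum f ≈ 0# → ∀ i → f i ≈ 0#
  sum-nonNeg≈0⇒≈0 {suc m} {f} 0≤f Σf≈0 = ∀-cons f₀≈0 (sum-nonNeg≈0⇒≈0 (0≤f ∘ suc) Σf∘suc≈0)
    where
    f₀≤0 : f zero ≤ 0#
    f₀≤0 = ≤-resp-≈ (+-identityʳ _) Σf≈0 (+-monoʳ-≤ (f zero) (sum-nonNeg (0≤f ∘ suc)))
    f₀≈0 : f zero ≈ 0#
    f₀≈0 = ≤-antisym f₀≤0 (0≤f zero)
    Σf∘suc≈0 : sum (f ∘ suc) ≈ 0#
    Σf∘suc≈0 = ≤-antisym (≤-resp-≈ (+-identityˡ _) Σf≈0 (+-monoˡ-≤ (sum (f ∘ suc)) (0≤f zero)))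
                         (sum-nonNeg (0≤f ∘ suc))

  𝟙 : ∀ {p} {P : Set p} → Dec P → Carrier
  𝟙 (yes _) = 1#
  𝟙 (no _)  = 0#

module FinDoubleNegation where

  open import Data.Nat using (zero; suc)
  open import Data.Fin using (Fin; zero; suc)
  open import Data.Fin.Properties using (∀-cons)
  open import Data.Product using (∃; _,_)
  open import Data.Sum using (_⊎_; inj₁; inj₂)
  open import Function using (_∘_)
  open import Relation.Nullary using (¬_)

  ¬¬-Π : ∀ {m p} {P : Fin m → Set p} → (∀ i → ¬ ¬ P i) → ¬ ¬ (∀ i → P i)
  ¬¬-Π {zero}  _   ¬∀ = ¬∀ λ ()
  ¬¬-Π {suc m} ¬¬P ¬∀ = ¬¬P zero λ P₀ → ¬¬-Π (¬¬P ∘ suc) (¬∀ ∘ ∀-cons P₀)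

  ¬¬-all-or-counterexample : ∀ {m p} (P : Fin m → Set p) → ¬ ¬ ((∀ i → P i) ⊎ ∃ λ i → ¬ P i)
  ¬¬-all-or-counterexample P k = ¬¬-Π (λ i ¬Pi → k (inj₂ (i , ¬Pi))) (k ∘ inj₁)

module Determinant {c ℓ₁ ℓ₂} (F : OrderedField c ℓ₁ ℓ₂) where

  open import Data.Nat as ℕ using (ℕ; zero; suc)
  import Data.Nat.Properties as ℕ
  open import Data.Fin using (Fin; zero; suc; punchIn; punchOut; inject₁; toℕ; _<_)
  open import Data.Fin.Properties
    using ( _≟_; punchInᵢ≢i; punchIn-punchOut; punchIn-injective; suc-injective
          ; toℕ-inject₁; toℕ-injective; <-cmp; <⇒≢ )
  open import Data.Fin.Induction using (<-weakInduction)
  open import Data.Product using (Σ; _,_)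
  open import Data.Vec.Functional using (updateAt)
  open import Data.Vec.Functional.Properties using (updateAt-updates; updateAt-minimal)
  open import Function using (_∘_; const)
  open import Relation.Binary.Definitions using (tri<; tri≈; tri>)
  open import Relation.Binary.PropositionalEquality as ≡ using (_≡_; _≢_)
  open import Relation.Nullary using (yes; no; contradiction)

  open OrderedFieldProperties F
  open Linear F using (altSum; det)

  Matrix : ℕ → ℕ → Set c
  Matrix r n = Fin r → Fin n → Carrier

  minor : ∀ {m} → Fin (suc m) → Matrix (suc m) (suc m) → Matrix m m
  minor j A r s = A (suc r) (punchIn j s)

  laplaceTerm : ∀ {m} → Matrix (suc m) (suc m) → Fin (suc m) → Carrier
  laplaceTerm A j = A zero j * det (minor j A)

  sign : ∀ {m} → Fin m → Carrier
  sign zero    = 1#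
  sign (suc j) = - sign j

  sign≉0 : ∀ {m} (j : Fin m) → sign j ≉ 0#
  sign≉0 zero    = 0≉1 ∘ sym
  sign≉0 (suc j) -s≈0 = sign≉0 j (trans (sym (-‿involutive _)) (trans (-‿cong -s≈0) ε⁻¹≈ε))

  altSum-cong : ∀ {m} {f g : Fin m → Carrier} → (∀ i → f i ≈ g i) → altSum f ≈ altSum g
  altSum-cong {zero}  f≈g = refl
  altSum-cong {suc m} f≈g = +-cong (f≈g zero) (-‿cong (altSum-cong (f≈g ∘ suc)))

  altSum-linear : ∀ {m} (a b : Carrier) (f g : Fin m → Carrier) →
                  altSum (λ i → a * f i + b * g i) ≈ a * altSum f + b * altSum g
  altSum-linear {zero}  a b f g = sym (trans (+-cong (zeroʳ a) (zeroʳ b)) (+-identityʳ 0#))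
  altSum-linear {suc m} a b f g = begin
    (a * f zero + b * g zero) - altSum (λ i → a * f (suc i) + b * g (suc i))
      ≈⟨ +-congˡ (-‿cong (altSum-linear a b (f ∘ suc) (g ∘ suc))) ⟩
    (a * f zero + b * g zero) - (a * altSum (f ∘ suc) + b * altSum (g ∘ suc))
      ≈⟨ solve 6 (λ a b f₀ g₀ F G → (a :* f₀ :+ b :* g₀) :- (a :* F :+ b :* G) := a :* (f₀ :- F) :+ b :* (g₀ :- G))
               refl a b (f zero) (g zero) _ _ ⟩
    a * (f zero - altSum (f ∘ suc)) + b * (g zero - altSum (g ∘ suc)) ∎

  altSum-neg : ∀ {m} (f : Fin m → Carrier) → altSum (λ i → - f i) ≈ - altSum f
  altSum-neg {zero}  f = sym ε⁻¹≈ε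
  altSum-neg {suc m} f = trans (+-congˡ (-‿cong (altSum-neg (f ∘ suc))))
    (solve 2 (λ a r → :- a :- :- r := :- (a :- r)) refl (f zero) _)

  altSum-zero : ∀ {m} {f : Fin m → Carrier} → (∀ i → f i ≈ 0#) → altSum f ≈ 0#
  altSum-zero {zero}  f≈0 = refl
  altSum-zero {suc m} f≈0 = trans (+-cong (f≈0 zero) (-‿cong (altSum-zero (f≈0 ∘ suc)))) (-‿inverseʳ 0#)

  altSum-δ : ∀ {m} (q : Fin m) {f : Fin m → Carrier} → (∀ j → j ≢ q → f j ≈ 0#) → altSum f ≈ sign q * f q
  altSum-δ zero    {f} f≈0 = begin
    f zero - altSum (f ∘ suc) ≈⟨ y≈0⇒x-y≈x (f zero) (altSum-zero λ i → f≈0 (suc i) λ ()) ⟩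
    f zero                    ≈⟨ *-identityˡ (f zero) ⟨
    1# * f zero               ∎
  altSum-δ (suc q) {f} f≈0 = begin
    f zero - altSum (f ∘ suc)
      ≈⟨ +-cong (f≈0 zero λ ()) (-‿cong (altSum-δ q λ j j≢q → f≈0 (suc j) (j≢q ∘ suc-injective))) ⟩
    0# - sign q * f (suc q)       ≈⟨ +-identityˡ _ ⟩
    - (sign q * f (suc q))        ≈⟨ -‿distribˡ-* (sign q) (f (suc q)) ⟩
    - sign q * f (suc q)          ∎

  det-cong : ∀ {m} {A B : Matrix m m} → (∀ i j → A i j ≈ B i j) → det A ≈ det B
  det-cong {zero}  A≈B = refl
  det-cong {suc m} A≈B = altSum-cong λ j → *-cong (A≈B zero j) (det-cong λ r s → A≈B (suc r) (punchIn j s))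

  replaceColumn : ∀ {r n} → Matrix r n → Fin n → (Fin r → Carrier) → Matrix r n
  replaceColumn A q u i = updateAt (A i) q (const (u i))

  module _ {r n} (A : Matrix r n) (q : Fin n) (u : Fin r → Carrier) where

    replaceColumn-at : ∀ i → replaceColumn A q u i q ≈ u i
    replaceColumn-at i = reflexive (updateAt-updates q (A i))

    replaceColumn-elsewhere : ∀ i {j} → j ≢ q → replaceColumn A q u i j ≈ A i j
    replaceColumn-elsewhere i {j} j≢q = reflexive (updateAt-minimal j q (A i) j≢q)

  replaceColumn-cong : ∀ {r n} {A B : Matrix r n} q {u v : Fin r → Carrier} →
                       (∀ i j → A i j ≈ B i j) → (∀ i → u i ≈ v i) →
                       ∀ i j → replaceColumn A q u i j ≈ replaceColumn B q v i j
  replaceColumn-cong {A = A} {B} q {u} {v} A≈B u≈v i j with j ≟ q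
  ... | yes ≡.refl = trans (replaceColumn-at A j u i) (trans (u≈v i) (sym (replaceColumn-at B j v i)))
  ... | no j≢q     = trans (replaceColumn-elsewhere A q u i j≢q)
                           (trans (A≈B i j) (sym (replaceColumn-elsewhere B q v i j≢q)))

  module _ {m} (A : Matrix (suc m) (suc m)) (q : Fin (suc m)) (u : Fin (suc m) → Carrier) where

    laplaceTerm-replaceColumn-at : laplaceTerm (replaceColumn A q u) q ≈ u zero * det (minor q A)
    laplaceTerm-replaceColumn-at =
      *-cong (replaceColumn-at A q u zero) (det-cong λ r s → replaceColumn-elsewhere A q u (suc r) (punchInᵢ≢i q s))

    laplaceTerm-replaceColumn-elsewhere : ∀ {j} (j≢q : j ≢ q) →
      laplaceTerm (replaceColumn A q u) j ≈ A zero j * det (replaceColumn (minor j A) (punchOut j≢q) (u ∘ suc))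
    laplaceTerm-replaceColumn-elsewhere {j} j≢q =
      *-cong (replaceColumn-elsewhere A q u zero j≢q) (det-cong minor-entry)
      where
      minor-entry : ∀ r s → minor j (replaceColumn A q u) r s ≈ replaceColumn (minor j A) (punchOut j≢q) (u ∘ suc) r s
      minor-entry r s with s ≟ punchOut j≢q
      ... | yes ≡.refl = trans (reflexive (≡.cong (replaceColumn A q u (suc r)) (punchIn-punchOut j≢q)))
                               (trans (replaceColumn-at A q u (suc r)) (sym (replaceColumn-at (minor j A) _ (u ∘ suc) r)))
      ... | no s≢q′    = trans (replaceColumn-elsewhere A q u (suc r) punchIn≢q)
                               (sym (replaceColumn-elsewhere (minor j A) _ (u ∘ suc) r s≢q′))
        where
        punchIn≢q : punchIn j s ≢ q
        punchIn≢q e = s≢q′ (punchIn-injective j s _ (≡.trans e (≡.sym (punchIn-punchOut j≢q))))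

  det-linear : ∀ {m} (A : Matrix m m) q (a b : Carrier) (u w : Fin m → Carrier) →
               det (replaceColumn A q (λ i → a * u i + b * w i))
                 ≈ a * det (replaceColumn A q u) + b * det (replaceColumn A q w)
  det-linear {suc m} A q a b u w =
    trans (altSum-cong term) (altSum-linear a b (laplaceTerm (replaceColumn A q u)) (laplaceTerm (replaceColumn A q w)))
    where
    v : Fin (suc m) → Carrier
    v i = a * u i + b * w i
    term : ∀ j → laplaceTerm (replaceColumn A q v) j
                 ≈ a * laplaceTerm (replaceColumn A q u) j + b * laplaceTerm (replaceColumn A q w) j
    term j with j ≟ q
    ... | yes ≡.refl = begin
      laplaceTerm (replaceColumn A j v) j         ≈⟨ laplaceTerm-replaceColumn-at A j v ⟩
      (a * u zero + b * w zero) * det (minor j A)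
        ≈⟨ solve 5 (λ a b u w d → (a :* u :+ b :* w) :* d := a :* (u :* d) :+ b :* (w :* d))
                   refl a b (u zero) (w zero) _ ⟩
      a * (u zero * det (minor j A)) + b * (w zero * det (minor j A))
        ≈⟨ +-cong (*-congˡ (laplaceTerm-replaceColumn-at A j u)) (*-congˡ (laplaceTerm-replaceColumn-at A j w)) ⟨
      a * laplaceTerm (replaceColumn A j u) j + b * laplaceTerm (replaceColumn A j w) j ∎
    ... | no j≢q = begin
      laplaceTerm (replaceColumn A q v) j
        ≈⟨ laplaceTerm-replaceColumn-elsewhere A q v j≢q ⟩
      A zero j * det (replaceColumn (minor j A) q′ (v ∘ suc))
        ≈⟨ *-congˡ (det-linear (minor j A) q′ a b (u ∘ suc) (w ∘ suc)) ⟩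
      A zero j * (a * det (replaceColumn (minor j A) q′ (u ∘ suc)) + b * det (replaceColumn (minor j A) q′ (w ∘ suc)))
        ≈⟨ solve 5 (λ x a b d e → x :* (a :* d :+ b :* e) := a :* (x :* d) :+ b :* (x :* e))
                   refl (A zero j) a b _ _ ⟩
      a * (A zero j * det (replaceColumn (minor j A) q′ (u ∘ suc)))
        + b * (A zero j * det (replaceColumn (minor j A) q′ (w ∘ suc)))
        ≈⟨ +-cong (*-congˡ (laplaceTerm-replaceColumn-elsewhere A q u j≢q))
                  (*-congˡ (laplaceTerm-replaceColumn-elsewhere A q w j≢q)) ⟨
      a * laplaceTerm (replaceColumn A q u) j + b * laplaceTerm (replaceColumn A q w) j ∎
      where
      q′ : Fin m
      q′ = punchOut j≢q

  swap : ∀ {n} → Fin n → Fin (suc n) → Fin (suc n)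
  swap zero    zero          = suc zero
  swap zero    (suc zero)    = zero
  swap zero    (suc (suc i)) = suc (suc i)
  swap (suc t) zero          = zero
  swap (suc t) (suc i)       = suc (swap t i)

  swap-inject₁ : ∀ {n} (t : Fin n) → swap t (inject₁ t) ≡ suc t
  swap-inject₁ zero    = ≡.refl
  swap-inject₁ (suc t) = ≡.cong suc (swap-inject₁ t)

  swap-suc : ∀ {n} (t : Fin n) → swap t (suc t) ≡ inject₁ t
  swap-suc zero    = ≡.refl
  swap-suc (suc t) = ≡.cong suc (swap-suc t)

  swap-punchIn-inject₁ : ∀ {n} (t : Fin n) s → swap t (punchIn (inject₁ t) s) ≡ punchIn (suc t) s
  swap-punchIn-inject₁ zero    zero    = ≡.refl
  swap-punchIn-inject₁ zero    (suc s) = ≡.refl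
  swap-punchIn-inject₁ (suc t) zero    = ≡.refl
  swap-punchIn-inject₁ (suc t) (suc s) = ≡.cong suc (swap-punchIn-inject₁ t s)

  swap-punchIn-suc : ∀ {n} (t : Fin n) s → swap t (punchIn (suc t) s) ≡ punchIn (inject₁ t) s
  swap-punchIn-suc zero    zero    = ≡.refl
  swap-punchIn-suc zero    (suc s) = ≡.refl
  swap-punchIn-suc (suc t) zero    = ≡.refl
  swap-punchIn-suc (suc t) (suc s) = ≡.cong suc (swap-punchIn-suc t s)

  swap-fixes : ∀ {n} (t : Fin n) {j} → j ≢ inject₁ t → j ≢ suc t → swap t j ≡ j
  swap-fixes zero    {zero}          j≢t _    = contradiction ≡.refl j≢t
  swap-fixes zero    {suc zero}      _   j≢t+1 = contradiction ≡.refl j≢t+1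
  swap-fixes zero    {suc (suc j)}   _   _    = ≡.refl
  swap-fixes (suc t) {zero}          _   _    = ≡.refl
  swap-fixes (suc t) {suc j}         j≢t j≢t+1 = ≡.cong suc (swap-fixes t (j≢t ∘ ≡.cong suc) (j≢t+1 ∘ ≡.cong suc))

  swap-punchIn : ∀ {n} (t : Fin (suc n)) {j} → j ≢ inject₁ t → j ≢ suc t →
                 Σ (Fin n) λ t′ → ∀ s → swap t (punchIn j s) ≡ punchIn j (swap t′ s)
  swap-punchIn zero          {zero}        j≢t _     = contradiction ≡.refl j≢t
  swap-punchIn zero          {suc zero}    _   j≢t+1 = contradiction ≡.refl j≢t+1
  swap-punchIn {suc n} zero  {suc (suc j)} _   _     =
    zero , λ { zero → ≡.refl ; (suc zero) → ≡.refl ; (suc (suc s)) → ≡.refl }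
  swap-punchIn {suc n} (suc t) {zero}      _   _     = t , λ s → ≡.refl
  swap-punchIn {suc n} (suc t) {suc j}     j≢t j≢t+1 with swap-punchIn t (j≢t ∘ ≡.cong suc) (j≢t+1 ∘ ≡.cong suc)
  ... | t′ , commute = suc t′ , λ { zero → ≡.refl ; (suc s) → ≡.cong suc (commute s) }

  altSum-swap : ∀ {n} (t : Fin (suc n)) (f g : Fin (suc (suc n)) → Carrier) →
                g (inject₁ t) ≈ f (suc t) → g (suc t) ≈ f (inject₁ t) →
                (∀ j → j ≢ inject₁ t → j ≢ suc t → g j ≈ - f j) → altSum g ≈ - altSum f
  altSum-swap zero f g g₀≈f₁ g₁≈f₀ g≈-f = begin
    g zero - (g (suc zero) - altSum g₂)  ≈⟨ +-cong g₀≈f₁ (-‿cong (+-cong g₁≈f₀ (-‿cong g₂≈-f₂))) ⟩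
    f (suc zero) - (f zero - - altSum f₂)
      ≈⟨ solve 3 (λ a b r → b :- (a :- :- r) := :- (a :- (b :- r))) refl (f zero) (f (suc zero)) _ ⟩
    - (f zero - (f (suc zero) - altSum f₂)) ∎
    where
    f₂ g₂ : Fin _ → Carrier
    f₂ i = f (suc (suc i))
    g₂ i = g (suc (suc i))
    g₂≈-f₂ : altSum g₂ ≈ - altSum f₂
    g₂≈-f₂ = trans (altSum-cong λ i → g≈-f (suc (suc i)) (λ ()) (λ ())) (altSum-neg f₂)
  altSum-swap {suc n} (suc t) f g g≈f g≈f′ g≈-f = begin
    g zero - altSum (g ∘ suc)
      ≈⟨ +-cong (g≈-f zero (λ ()) (λ ()))
                (-‿cong (altSum-swap t (f ∘ suc) (g ∘ suc) g≈f g≈f′ g∘suc≈-f∘suc)) ⟩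
    - f zero - - altSum (f ∘ suc) ≈⟨ solve 2 (λ a r → :- a :- :- r := :- (a :- r)) refl (f zero) _ ⟩
    - (f zero - altSum (f ∘ suc)) ∎
    where
    g∘suc≈-f∘suc : ∀ j → j ≢ inject₁ t → j ≢ suc t → g (suc j) ≈ - f (suc j)
    g∘suc≈-f∘suc j j≢t j≢t+1 = g≈-f (suc j) (j≢t ∘ suc-injective) (j≢t+1 ∘ suc-injective)

  swapColumns : ∀ {r n} → Fin n → Matrix r (suc n) → Matrix r (suc n)
  swapColumns t A i j = A i (swap t j)

  det-swapColumns : ∀ {n} (t : Fin n) (A : Matrix (suc n) (suc n)) → det (swapColumns t A) ≈ - det A
  det-swapColumns {suc n} t A = altSum-swap t (laplaceTerm A) (laplaceTerm (swapColumns t A)) at-t at-t+1 elsewhere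
    where
    at-t : laplaceTerm (swapColumns t A) (inject₁ t) ≈ laplaceTerm A (suc t)
    at-t = *-cong (reflexive (≡.cong (A zero) (swap-inject₁ t)))
                  (det-cong λ r s → reflexive (≡.cong (A (suc r)) (swap-punchIn-inject₁ t s)))
    at-t+1 : laplaceTerm (swapColumns t A) (suc t) ≈ laplaceTerm A (inject₁ t)
    at-t+1 = *-cong (reflexive (≡.cong (A zero) (swap-suc t)))
                    (det-cong λ r s → reflexive (≡.cong (A (suc r)) (swap-punchIn-suc t s)))
    elsewhere : ∀ j → j ≢ inject₁ t → j ≢ suc t → laplaceTerm (swapColumns t A) j ≈ - laplaceTerm A j
    elsewhere j j≢t j≢t+1 with swap-punchIn t j≢t j≢t+1
    ... | t′ , commute = begin
      A zero (swap t j) * det (minor j (swapColumns t A))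
        ≈⟨ *-cong (reflexive (≡.cong (A zero) (swap-fixes t j≢t j≢t+1)))
                  (det-cong λ r s → reflexive (≡.cong (A (suc r)) (commute s))) ⟩
      A zero j * det (swapColumns t′ (minor j A)) ≈⟨ *-congˡ (det-swapColumns t′ (minor j A)) ⟩
      A zero j * - det (minor j A)                ≈⟨ -‿distribʳ-* _ _ ⟨
      - laplaceTerm A j                           ∎

  det-adjacent-equal-columns : ∀ {n} (t : Fin n) (A : Matrix (suc n) (suc n)) →
                               (∀ i → A i (inject₁ t) ≈ A i (suc t)) → det A ≈ 0#
  det-adjacent-equal-columns t A equal = x≈-x⇒x≈0 (trans (det-cong A≈swapped) (det-swapColumns t A))
    where
    A≈swapped : ∀ i j → A i j ≈ swapColumns t A i j
    A≈swapped i j with j ≟ inject₁ t | j ≟ suc t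
    ... | yes ≡.refl | _          = trans (equal i) (reflexive (≡.cong (A i) (≡.sym (swap-inject₁ t))))
    ... | no _       | yes ≡.refl = trans (sym (equal i)) (reflexive (≡.cong (A i) (≡.sym (swap-suc t))))
    ... | no j≢t     | no j≢t+1   = reflexive (≡.cong (A i) (≡.sym (swap-fixes t j≢t j≢t+1)))

  -- Move the right-hand copy leftwards by adjacent swaps until the copies are neighbours.
  det-equal-columns-< : ∀ {m} (A : Matrix m m) {p q} → p < q → (∀ i → A i p ≈ A i q) → det A ≈ 0#
  det-equal-columns-< {suc zero}    A {zero} {zero} ()
  det-equal-columns-< {suc (suc n)} A {p} {q} = <-weakInduction P base step q A p
    where
    P : Fin (suc (suc n)) → Set _
    P q = ∀ (A : Matrix (suc (suc n)) (suc (suc n))) p → p < q → (∀ i → A i p ≈ A i q) → det A ≈ 0#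
    base : P zero
    base A p ()
    step : ∀ t → P (inject₁ t) → P (suc t)
    step t IH A p p<t+1 equal with p ≟ inject₁ t
    ... | yes ≡.refl = det-adjacent-equal-columns t A equal
    ... | no p≢t     = begin
      det A                        ≈⟨ -‿involutive _ ⟨
      - - det A                    ≈⟨ -‿cong (det-swapColumns t A) ⟨
      - det (swapColumns t A)      ≈⟨ -‿cong (IH (swapColumns t A) p p<t equal′) ⟩
      - 0#                         ≈⟨ ε⁻¹≈ε ⟩
      0#                           ∎
      where
      p<t : p < inject₁ t
      p<t = ≡.subst (toℕ p ℕ.<_) (≡.sym (toℕ-inject₁ t))
              (ℕ.≤∧≢⇒< (ℕ.≤-pred p<t+1) λ e → p≢t (toℕ-injective (≡.trans e (≡.sym (toℕ-inject₁ t)))))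
      equal′ : ∀ i → swapColumns t A i p ≈ swapColumns t A i (inject₁ t)
      equal′ i = begin
        A i (swap t p)           ≡⟨ ≡.cong (A i) (swap-fixes t p≢t (<⇒≢ p<t+1)) ⟩
        A i p                    ≈⟨ equal i ⟩
        A i (suc t)              ≡⟨ ≡.cong (A i) (swap-inject₁ t) ⟨
        A i (swap t (inject₁ t)) ∎

  det-equal-columns : ∀ {m} (A : Matrix m m) {p q} → p ≢ q → (∀ i → A i p ≈ A i q) → det A ≈ 0#
  det-equal-columns A {p} {q} p≢q equal with <-cmp p q
  ... | tri< p<q _ _ = det-equal-columns-< A p<q equal
  ... | tri≈ _ p≡q _ = contradiction p≡q p≢q
  ... | tri> _ _ q<p = det-equal-columns-< A q<p (sym ∘ equal)

  module _ {m} (A : Matrix m m) (q : Fin m) where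

    det-replaceColumn-cong : ∀ {u v : Fin m → Carrier} → (∀ i → u i ≈ v i) →
                             det (replaceColumn A q u) ≈ det (replaceColumn A q v)
    det-replaceColumn-cong u≈v = det-cong (replaceColumn-cong q (λ _ _ → refl) u≈v)

    det-replaceColumn-self : det (replaceColumn A q (λ i → A i q)) ≈ det A
    det-replaceColumn-self = det-cong entry
      where
      entry : ∀ i j → replaceColumn A q (λ i → A i q) i j ≈ A i j
      entry i j with j ≟ q
      ... | yes ≡.refl = replaceColumn-at A j (λ i → A i j) i
      ... | no j≢q     = replaceColumn-elsewhere A q (λ i → A i q) i j≢q

    det-replaceColumn-scale : ∀ a (u : Fin m → Carrier) →
                              det (replaceColumn A q (λ i → a * u i)) ≈ a * det (replaceColumn A q u)
    det-replaceColumn-scale a u = begin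
      det (replaceColumn A q (λ i → a * u i))
        ≈⟨ det-replaceColumn-cong (λ i → sym (drop-0* (a * u i) (u i))) ⟩
      det (replaceColumn A q (λ i → a * u i + 0# * u i))         ≈⟨ det-linear A q a 0# u u ⟩
      a * det (replaceColumn A q u) + 0# * det (replaceColumn A q u) ≈⟨ drop-0* _ _ ⟩
      a * det (replaceColumn A q u)                              ∎
      where
      drop-0* : ∀ x y → x + 0# * y ≈ x
      drop-0* x y = trans (+-congˡ (zeroˡ y)) (+-identityʳ x)

    det-replaceColumn-zero : det (replaceColumn A q (const 0#)) ≈ 0#
    det-replaceColumn-zero = begin
      det (replaceColumn A q (const 0#))          ≈⟨ det-replaceColumn-cong (λ _ → sym (zeroˡ 0#)) ⟩
      det (replaceColumn A q (λ _ → 0# * 0#))     ≈⟨ det-replaceColumn-scale 0# (const 0#) ⟩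
      0# * det (replaceColumn A q (const 0#))     ≈⟨ zeroˡ _ ⟩
      0#                                          ∎

    det-replaceColumn-sum : ∀ {k} (λs : Fin k → Carrier) (V : Fin k → Fin m → Carrier) →
      det (replaceColumn A q (λ i → sum (λ l → λs l * V l i))) ≈ sum (λ l → λs l * det (replaceColumn A q (V l)))
    det-replaceColumn-sum {zero}  λs V = det-replaceColumn-zero
    det-replaceColumn-sum {suc k} λs V = begin
      det (replaceColumn A q (λ i → λs zero * V zero i + rest i))
        ≈⟨ det-replaceColumn-cong (λ i → +-congˡ (sym (*-identityˡ (rest i)))) ⟩
      det (replaceColumn A q (λ i → λs zero * V zero i + 1# * rest i))
        ≈⟨ det-linear A q (λs zero) 1# (V zero) rest ⟩
      λs zero * det (replaceColumn A q (V zero)) + 1# * det (replaceColumn A q rest)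
        ≈⟨ +-congˡ (trans (*-identityˡ _) (det-replaceColumn-sum (λs ∘ suc) (V ∘ suc))) ⟩
      λs zero * det (replaceColumn A q (V zero)) + sum (λ l → λs (suc l) * det (replaceColumn A q (V (suc l)))) ∎
      where
      rest : Fin m → Carrier
      rest i = sum (λ l → λs (suc l) * V (suc l) i)

    -- Every column l ≢ q contributes a determinant with two equal columns.
    det-replaceColumn-combination : ∀ (λs : Fin m → Carrier) →
      det (replaceColumn A q (λ i → sum (λ l → λs l * A i l))) ≈ λs q * det A
    det-replaceColumn-combination λs = begin
      det (replaceColumn A q (λ i → sum (λ l → λs l * A i l))) ≈⟨ det-replaceColumn-sum λs (λ l i → A i l) ⟩
      sum (λ l → λs l * det (replaceColumn A q (λ i → A i l))) ≈⟨ sum-δ′ ⟩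
      λs q * det (replaceColumn A q (λ i → A i q))             ≈⟨ *-congˡ det-replaceColumn-self ⟩
      λs q * det A                                             ∎
      where
      sum-δ′ : sum (λ l → λs l * det (replaceColumn A q (λ i → A i l)))
               ≈ λs q * det (replaceColumn A q (λ i → A i q))
      sum-δ′ = sum-δ q λ l l≢q → trans (*-congˡ (det-equal-columns _ (l≢q ∘ ≡.sym) (equal l l≢q))) (zeroʳ _)
        where
        equal : ∀ l → l ≢ q → ∀ i → replaceColumn A q (λ i → A i l) i q ≈ replaceColumn A q (λ i → A i l) i l
        equal l l≢q i = trans (replaceColumn-at A q (λ i → A i l) i) (sym (replaceColumn-elsewhere A q (λ i → A i l) i l≢q))

    det-factor-eigenvalue : ∀ (u : Fin m → Carrier) y → u q ≈ 1# →
      (∀ i → sum (λ l → u l * A i l) ≈ y * u i) → det A ≈ y * det (replaceColumn A q u)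
    det-factor-eigenvalue u y u_q≈1 eigen = begin
      det A                                          ≈⟨ *-identityˡ _ ⟨
      1# * det A                                     ≈⟨ *-congʳ u_q≈1 ⟨
      u q * det A                                    ≈⟨ det-replaceColumn-combination u ⟨
      det (replaceColumn A q (λ i → sum (λ l → u l * A i l))) ≈⟨ det-replaceColumn-cong eigen ⟩
      det (replaceColumn A q (λ i → y * u i))        ≈⟨ det-replaceColumn-scale y u ⟩
      y * det (replaceColumn A q u)                  ∎

  det-replaceColumn-e₀ : ∀ {m} (A : Matrix (suc m) (suc m)) q (u : Fin (suc m) → Carrier) →
                         (∀ i → u (suc i) ≈ 0#) → det (replaceColumn A q u) ≈ sign q * (u zero * det (minor q A))
  det-replaceColumn-e₀ {m} A q u u≈0 = trans (altSum-δ q vanishes) (*-congˡ (laplaceTerm-replaceColumn-at A q u))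
    where
    vanishes : ∀ j → j ≢ q → laplaceTerm (replaceColumn A q u) j ≈ 0#
    vanishes j j≢q = begin
      laplaceTerm (replaceColumn A q u) j                      ≈⟨ laplaceTerm-replaceColumn-elsewhere A q u j≢q ⟩
      A zero j * det (replaceColumn (minor j A) q′ (u ∘ suc))  ≈⟨ *-congˡ (det-replaceColumn-cong (minor j A) q′ u≈0) ⟩
      A zero j * det (replaceColumn (minor j A) q′ (const 0#)) ≈⟨ *-congˡ (det-replaceColumn-zero (minor j A) q′) ⟩
      A zero j * 0#                                            ≈⟨ zeroʳ _ ⟩
      0#                                                       ∎
      where
      q′ : Fin m
      q′ = punchOut j≢q

module LinearSystems {c ℓ₁ ℓ₂} (F : OrderedField c ℓ₁ ℓ₂) where

  open import Level using (_⊔_)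
  open import Data.Nat as ℕ using (ℕ; zero; suc)
  import Data.Nat.Properties as ℕ
  open import Data.Fin using (Fin; zero; suc; punchIn)
  open import Data.Fin.Properties using (∀-cons)
  open import Data.Product using (∃; _×_; _,_)
  open import Data.Sum using (inj₁; inj₂)
  open import Data.Vec.Functional using (insertAt)
  open import Data.Vec.Functional.Properties using (insertAt-lookup; insertAt-punchIn)
  open import Function using (_∘_; const)
  open import Relation.Nullary using (¬_; yes; no; contradiction)
  open import Relation.Nullary.Decidable using (¬¬-excluded-middle)

  open OrderedFieldProperties F
  open Linear F using (det)
  open Determinant F
  open FinDoubleNegation

  infixr 7 _*ᵥ_
  _*ᵥ_ : ∀ {r n} → Matrix r n → (Fin n → Carrier) → Fin r → Carrier
  (A *ᵥ v) i = sum (λ l → A i l * v l)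

  NonZero : ∀ {n} → (Fin n → Carrier) → Set ℓ₁
  NonZero v = ∃ λ j → v j ≉ 0#

  HasNontrivialKernel : ∀ {r n} → Matrix r n → Set (c ⊔ ℓ₁)
  HasNontrivialKernel A = ∃ λ v → NonZero v × (∀ i → (A *ᵥ v) i ≈ 0#)

  *ᵥ-insertAt : ∀ {r n} (A : Matrix r (suc n)) (w : Fin n → Carrier) j x i →
                (A *ᵥ insertAt w j x) i ≈ A i j * x + ((λ r s → A r (punchIn j s)) *ᵥ w) i
  *ᵥ-insertAt A w j x i = trans (sum-remove {i = j} (λ l → A i l * insertAt w j x l))
    (+-cong (*-congˡ (reflexive (insertAt-lookup w j x))) (sum-cong-≋ λ s → *-congˡ (reflexive (insertAt-punchIn w j x s))))

  -- One step of Gaussian elimination with pivot A₀ⱼ, where y is its inverse.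
  eliminate : ∀ {r n} → Matrix (suc r) (suc n) → Fin (suc n) → Carrier → Matrix r n
  eliminate A j y r s = A (suc r) (punchIn j s) - A zero (punchIn j s) * y * A (suc r) j

  module _ {r n} (A : Matrix (suc r) (suc n)) (j : Fin (suc n)) (y : Carrier) (A₀ⱼy≈1 : A zero j * y ≈ 1#) where

    eliminate-kernel⇒kernel : HasNontrivialKernel (eliminate A j y) → HasNontrivialKernel A
    eliminate-kernel⇒kernel (w , (p , w_p≉0) , Ew≈0) = v , (punchIn j p , v≉0) , Av≈0
      where
      A′ : Matrix (suc r) n
      A′ r s = A r (punchIn j s)
      S : Carrier
      S = (A′ *ᵥ w) zero
      v : Fin (suc n) → Carrier
      v = insertAt w j (- (y * S))
      v≉0 : v (punchIn j p) ≉ 0#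
      v≉0 = w_p≉0 ∘ trans (sym (reflexive (insertAt-punchIn w j _ p)))
      Av≈0 : ∀ i → (A *ᵥ v) i ≈ 0#
      Av≈0 zero = begin
        (A *ᵥ v) zero              ≈⟨ *ᵥ-insertAt A w j _ zero ⟩
        A zero j * - (y * S) + S
          ≈⟨ solve 3 (λ a y s → a :* :- (y :* s) :+ s := :- ((a :* y) :* s) :+ s) refl (A zero j) y S ⟩
        - ((A zero j * y) * S) + S ≈⟨ +-congʳ (-‿cong (*-congʳ A₀ⱼy≈1)) ⟩
        - (1# * S) + S             ≈⟨ +-congʳ (-‿cong (*-identityˡ S)) ⟩
        - S + S                    ≈⟨ -‿inverseˡ S ⟩
        0#                         ∎
      Av≈0 (suc i) = begin
        (A *ᵥ v) (suc i)                   ≈⟨ *ᵥ-insertAt A w j _ (suc i) ⟩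
        A (suc i) j * - (y * S) + T        ≈⟨ +-congˡ T≈kS ⟩
        A (suc i) j * - (y * S) + k * S
          ≈⟨ solve 3 (λ a y s → a :* :- (y :* s) :+ y :* a :* s := a :* y :* s :- a :* y :* s) refl (A (suc i) j) y S ⟩
        A (suc i) j * y * S - A (suc i) j * y * S ≈⟨ -‿inverseʳ _ ⟩
        0#                                 ∎
        where
        T k : Carrier
        T = (A′ *ᵥ w) (suc i)
        k = y * A (suc i) j
        Ew≈T-kS : (eliminate A j y *ᵥ w) i ≈ T - k * S
        Ew≈T-kS = begin
          sum (λ s → eliminate A j y i s * w s)
            ≈⟨ sum-cong-≋ (λ s → solve 5 (λ a b y c w → (a :- b :* y :* c) :* w := a :* w :+ :- (y :* c) :* (b :* w))
                                         refl (A′ (suc i) s) (A′ zero s) y (A (suc i) j) (w s)) ⟩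
          sum (λ s → A′ (suc i) s * w s + - k * (A′ zero s * w s))
            ≈⟨ ∑-distrib-+ (λ s → A′ (suc i) s * w s) (λ s → - k * (A′ zero s * w s)) ⟩
          T + sum (λ s → - k * (A′ zero s * w s)) ≈⟨ +-congˡ (*-distribˡ-sum (- k) (λ s → A′ zero s * w s)) ⟨
          T + - k * S                             ≈⟨ +-congˡ (-‿distribˡ-* k S) ⟨
          T - k * S                               ∎
        T≈kS : T ≈ k * S
        T≈kS = x-y≈0⇒x≈y (trans (sym Ew≈T-kS) (Ew≈0 i))

  underdetermined : ∀ {r n} → r ℕ.< n → (A : Matrix r n) → ¬ ¬ HasNontrivialKernel A
  underdetermined {zero}  {suc n} _   A noKernel = noKernel (const 1# , (zero , 0≉1 ∘ sym) , λ ())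
  underdetermined {suc r} {suc n} r<n A noKernel = ¬¬-all-or-counterexample (λ j → A zero j ≈ 0#) λ where
    (inj₁ A₀≈0) → underdetermined (ℕ.<⇒≤ r<n) (A ∘ suc) λ (v , v≉0 , A′v≈0) →
      noKernel (v , v≉0 , ∀-cons (sum-zero {f = λ l → A zero l * v l} λ l → trans (*-congʳ (A₀≈0 l)) (zeroˡ _))
                                 A′v≈0)
    (inj₂ (j , A₀ⱼ≉0)) → let (y , A₀ⱼy≈1) = inverse (A zero j) A₀ⱼ≉0 in
      underdetermined (ℕ.≤-pred r<n) (eliminate A j y) (noKernel ∘ eliminate-kernel⇒kernel A j y A₀ⱼy≈1)

  *ᵥ-linear : ∀ {r n} (A : Matrix r n) (a b : Carrier) (v w : Fin n → Carrier) i →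
              (A *ᵥ (λ l → a * v l + b * w l)) i ≈ a * (A *ᵥ v) i + b * (A *ᵥ w) i
  *ᵥ-linear A a b v w i = begin
    sum (λ l → A i l * (a * v l + b * w l))
      ≈⟨ sum-cong-≋ (λ l → solve 5 (λ x a b v w → x :* (a :* v :+ b :* w) := a :* (x :* v) :+ b :* (x :* w))
                                   refl (A i l) a b (v l) (w l)) ⟩
    sum (λ l → a * (A i l * v l) + b * (A i l * w l))
      ≈⟨ ∑-distrib-+ (λ l → a * (A i l * v l)) (λ l → b * (A i l * w l)) ⟩
    sum (λ l → a * (A i l * v l)) + sum (λ l → b * (A i l * w l))
      ≈⟨ +-cong (*-distribˡ-sum a (λ l → A i l * v l)) (*-distribˡ-sum b (λ l → A i l * w l)) ⟨
    a * (A *ᵥ v) i + b * (A *ᵥ w) i ∎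

  module _ {m} (A : Matrix (suc m) (suc m)) where

    -- Either w, or (A w)₀ · v − (A v)₀ · w, is killed by row 0 as well.
    combine-lower-kernels : ∀ {v w : Fin (suc m) → Carrier} {q} → v q ≉ 0# → w q ≈ 0# → NonZero w →
                            (∀ i → (A *ᵥ v) (suc i) ≈ 0#) → (∀ i → (A *ᵥ w) (suc i) ≈ 0#) →
                            ¬ ¬ HasNontrivialKernel A
    combine-lower-kernels {v} {w} {q} v_q≉0 w_q≈0 w≉0 A′v≈0 A′w≈0 noKernel =
      ¬¬-excluded-middle {A = t ≈ 0#} λ where
        (yes t≈0) → noKernel (w , w≉0 , ∀-cons t≈0 A′w≈0)
        (no t≉0)  → noKernel (u , (q , u_q≉0 t≉0) , Au≈0)
      where
      s t : Carrier
      s = (A *ᵥ v) zero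
      t = (A *ᵥ w) zero
      u : Fin (suc m) → Carrier
      u l = t * v l + (- s) * w l
      u_q≉0 : t ≉ 0# → u q ≉ 0#
      u_q≉0 t≉0 = x≉0∧y≉0⇒x*y≉0 t≉0 v_q≉0 ∘ trans (sym (y≈0⇒x+y≈x (trans (*-congˡ w_q≈0) (zeroʳ _))))
      Au≈0 : ∀ i → (A *ᵥ u) i ≈ 0#
      Au≈0 zero    = trans (*ᵥ-linear A t (- s) v w zero)
                           (trans (solve 2 (λ s t → t :* s :+ :- s :* t := s :- s) refl s t) (-‿inverseʳ s))
      Au≈0 (suc i) = trans (*ᵥ-linear A t (- s) v w (suc i))
                           (trans (+-cong (trans (*-congˡ (A′v≈0 i)) (zeroʳ t)) (trans (*-congˡ (A′w≈0 i)) (zeroʳ _)))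
                                  (+-identityʳ 0#))

    minor-singular : ∀ {v : Fin (suc m) → Carrier} {q} → v q ≉ 0# → (A *ᵥ v) zero ≉ 0# →
                     (∀ i → (A *ᵥ v) (suc i) ≈ 0#) → det A ≈ 0# → det (minor q A) ≈ 0#
    minor-singular {v} {q} v_q≉0 Av₀≉0 A′v≈0 det≈0 =
      x*y≈0⇒y≈0 Av₀≉0 (x*y≈0⇒y≈0 (sign≉0 q) (begin
        sign q * ((A *ᵥ v) zero * det (minor q A))     ≈⟨ det-replaceColumn-e₀ A q (A *ᵥ v) A′v≈0 ⟨
        det (replaceColumn A q (A *ᵥ v))
          ≈⟨ det-replaceColumn-cong A q (λ i → sum-cong-≋ λ l → *-comm (A i l) (v l)) ⟩
        det (replaceColumn A q (λ i → sum (λ l → v l * A i l))) ≈⟨ det-replaceColumn-combination A q v ⟩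
        v q * det A                                    ≈⟨ *-congˡ det≈0 ⟩
        v q * 0#                                       ≈⟨ zeroʳ _ ⟩
        0#                                             ∎))

    minor-kernel⇒lower-kernel : ∀ q {w} → (∀ i → (minor q A *ᵥ w) i ≈ 0#) →
                                ∀ i → (A *ᵥ insertAt w q 0#) (suc i) ≈ 0#
    minor-kernel⇒lower-kernel q {w} Mw≈0 i = begin
      (A *ᵥ insertAt w q 0#) (suc i)          ≈⟨ *ᵥ-insertAt A w q 0# (suc i) ⟩
      A (suc i) q * 0# + (minor q A *ᵥ w) i   ≈⟨ +-cong (zeroʳ _) (Mw≈0 i) ⟩
      0# + 0#                                 ≈⟨ +-identityʳ 0# ⟩
      0#                                      ∎

  -- Expanding a singular matrix along its first row: a kernel vector of the lower rows
  -- either already works, or it certifies that some minor is singular, and a kernel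
  -- vector of that minor supplies the missing correction.
  det≈0⇒¬¬kernel : ∀ {m} (A : Matrix m m) → det A ≈ 0# → ¬ ¬ HasNontrivialKernel A
  det≈0⇒¬¬kernel {zero}  A det≈0 = contradiction (sym det≈0) 0≉1
  det≈0⇒¬¬kernel {suc m} A det≈0 noKernel =
    underdetermined ℕ.≤-refl (A ∘ suc) λ (v , (q , v_q≉0) , A′v≈0) →
    ¬¬-excluded-middle {A = (A *ᵥ v) zero ≈ 0#} λ where
      (yes Av₀≈0) → noKernel (v , (q , v_q≉0) , ∀-cons Av₀≈0 A′v≈0)
      (no Av₀≉0)  → det≈0⇒¬¬kernel (minor q A) (minor-singular A {v} {q} v_q≉0 Av₀≉0 A′v≈0 det≈0)
                      λ (w , (p , w_p≉0) , Mw≈0) →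
        combine-lower-kernels A {v} {insertAt w q 0#} {q} v_q≉0 (reflexive (insertAt-lookup w q 0#))
          (punchIn q p , w_p≉0 ∘ trans (sym (reflexive (insertAt-punchIn w q 0# p))))
          A′v≈0 (minor-kernel⇒lower-kernel A q Mw≈0) noKernel

module Polynomial {c ℓ₁ ℓ₂} (F : OrderedField c ℓ₁ ℓ₂) where

  open import Level using (_⊔_)
  open import Data.Nat as ℕ using (ℕ; zero; suc; z≤n; s≤s)
  import Data.Nat.Properties as ℕ
  open import Data.Fin using (Fin; zero; suc; punchIn)
  open import Function using (_∘_; id; const)
  open import Relation.Binary.PropositionalEquality as ≡ using (_≡_)

  open OrderedFieldProperties F
  open Linear F using (altSum; det; prod)

  Δ : (Carrier → Carrier) → Carrier → Carrier
  Δ f x = f (x + 1#) - f x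

  -- Degree at most d, in the sense that the d-th finite difference is constant.
  IsPolynomial : ℕ → (Carrier → Carrier) → Set (c ⊔ ℓ₁)
  IsPolynomial zero    f = ∀ x y → f x ≈ f y
  IsPolynomial (suc d) f = IsPolynomial d (Δ f)

  IsPolynomial-cong : ∀ d {f g} → (∀ x → f x ≈ g x) → IsPolynomial d f → IsPolynomial d g
  IsPolynomial-cong zero    f≈g p x y = trans (sym (f≈g x)) (trans (p x y) (f≈g y))
  IsPolynomial-cong (suc d) f≈g p = IsPolynomial-cong d (λ x → +-cong (f≈g _) (-‿cong (f≈g x))) p

  IsPolynomial-const : ∀ d a → IsPolynomial d (const a)
  IsPolynomial-const zero    a x y = refl
  IsPolynomial-const (suc d) a = IsPolynomial-const d (a - a)

  IsPolynomial-id : IsPolynomial 1 id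
  IsPolynomial-id x y = trans (x+1-x≈1 x) (sym (x+1-x≈1 y))
    where
    x+1-x≈1 : ∀ x → (x + 1#) - x ≈ 1#
    x+1-x≈1 x = solve 2 (λ x o → (x :+ o) :- x := o) refl x 1#

  IsPolynomial-raise : ∀ e {f} → IsPolynomial 0 f → IsPolynomial e f
  IsPolynomial-raise zero    p = p
  IsPolynomial-raise (suc e) {f} p = IsPolynomial-raise e λ x y →
    trans (+-cong (p _ 0#) (-‿cong (p x 0#))) (sym (+-cong (p _ 0#) (-‿cong (p y 0#))))

  IsPolynomial-mono : ∀ {d e f} → d ℕ.≤ e → IsPolynomial d f → IsPolynomial e f
  IsPolynomial-mono {e = e} z≤n     p = IsPolynomial-raise e p
  IsPolynomial-mono         (s≤s d≤e) p = IsPolynomial-mono d≤e p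

  IsPolynomial-+ : ∀ d {f g} → IsPolynomial d f → IsPolynomial d g → IsPolynomial d (λ x → f x + g x)
  IsPolynomial-+ zero    pf pg x y = +-cong (pf x y) (pg x y)
  IsPolynomial-+ (suc d) {f} {g} pf pg = IsPolynomial-cong d Δ-+ (IsPolynomial-+ d pf pg)
    where
    Δ-+ : ∀ x → Δ f x + Δ g x ≈ Δ (λ x → f x + g x) x
    Δ-+ x = solve 4 (λ a b c e → a :- c :+ (b :- e) := a :+ b :- (c :+ e)) refl (f (x + 1#)) (g (x + 1#)) (f x) (g x)

  IsPolynomial-neg : ∀ d {f} → IsPolynomial d f → IsPolynomial d (λ x → - f x)
  IsPolynomial-neg zero    pf x y = -‿cong (pf x y)
  IsPolynomial-neg (suc d) {f} pf = IsPolynomial-cong d Δ-neg (IsPolynomial-neg d pf)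
    where
    Δ-neg : ∀ x → - Δ f x ≈ Δ (λ x → - f x) x
    Δ-neg x = solve 2 (λ a b → :- (a :- b) := :- a :- :- b) refl (f (x + 1#)) (f x)

  IsPolynomial-sub : ∀ d {f g} → IsPolynomial d f → IsPolynomial d g → IsPolynomial d (λ x → f x - g x)
  IsPolynomial-sub d pf pg = IsPolynomial-+ d pf (IsPolynomial-neg d pg)

  IsPolynomial-shift : ∀ d {f} → IsPolynomial d f → IsPolynomial d (λ x → f (x + 1#))
  IsPolynomial-shift zero    p x y = p _ _
  IsPolynomial-shift (suc d) p = IsPolynomial-shift d p

  -- Discrete Leibniz rule: Δ (f g) x = Δ f x · g (x + 1) + f x · Δ g x.
  IsPolynomial-* : ∀ a b {f g} → IsPolynomial a f → IsPolynomial b g → IsPolynomial (a ℕ.+ b) (λ x → f x * g x)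
  IsPolynomial-* zero zero pf pg x y = *-cong (pf x y) (pg x y)
  IsPolynomial-* zero (suc b) {f} {g} pf pg = IsPolynomial-cong b leibniz (IsPolynomial-* zero b pf pg)
    where
    leibniz : ∀ x → f x * Δ g x ≈ Δ (λ x → f x * g x) x
    leibniz x = begin
      f x * (g (x + 1#) - g x)          ≈⟨ solve 3 (λ a b c → a :* (b :- c) := a :* b :- a :* c) refl (f x) _ _ ⟩
      f x * g (x + 1#) - f x * g x      ≈⟨ +-congʳ (*-congʳ (pf x _)) ⟩
      f (x + 1#) * g (x + 1#) - f x * g x ∎
  IsPolynomial-* (suc a) b {f} {g} pf pg =
    IsPolynomial-cong (a ℕ.+ b) leibniz (IsPolynomial-+ (a ℕ.+ b) (IsPolynomial-* a b pf (IsPolynomial-shift b pg)) (f*Δg b pg))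
    where
    leibniz : ∀ x → Δ f x * g (x + 1#) + f x * Δ g x ≈ Δ (λ x → f x * g x) x
    leibniz x = solve 4 (λ a b c e → (a :- c) :* b :+ c :* (b :- e) := a :* b :- c :* e) refl (f (x + 1#)) (g (x + 1#)) (f x) (g x)
    f*Δg : ∀ b {g} → IsPolynomial b g → IsPolynomial (a ℕ.+ b) (λ x → f x * Δ g x)
    f*Δg zero {g} pg = IsPolynomial-cong (a ℕ.+ 0) (λ x → sym (trans (*-congˡ (Δg≈0 x)) (zeroʳ _)))
                         (IsPolynomial-const (a ℕ.+ 0) 0#)
      where
      Δg≈0 : ∀ x → Δ g x ≈ 0#
      Δg≈0 x = trans (+-congʳ (pg _ x)) (-‿inverseʳ _)
    f*Δg (suc b) {g} pg = ≡.subst (λ d → IsPolynomial d (λ x → f x * Δ g x)) (≡.sym (ℕ.+-suc a b))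
                            (IsPolynomial-* (suc a) b pf pg)

  IsPolynomial-altSum : ∀ d {k} (T : Carrier → Fin k → Carrier) → (∀ j → IsPolynomial d (λ x → T x j)) →
                        IsPolynomial d (λ x → altSum (T x))
  IsPolynomial-altSum d {zero}  T p = IsPolynomial-const d 0#
  IsPolynomial-altSum d {suc k} T p = IsPolynomial-sub d (p zero) (IsPolynomial-altSum d (λ x → T x ∘ suc) (p ∘ suc))

  IsPolynomial-det : ∀ m (A : Carrier → Fin m → Fin m → Carrier) → (∀ i j → IsPolynomial 1 (λ x → A x i j)) →
                     IsPolynomial m (λ x → det (A x))
  IsPolynomial-det zero    A p = IsPolynomial-const 0 1#
  IsPolynomial-det (suc m) A p = IsPolynomial-altSum (suc m) (λ x j → A x zero j * det (minor x j)) λ j →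
    IsPolynomial-* 1 m (p zero j) (IsPolynomial-det m (λ x → minor x j) λ r s → p (suc r) (punchIn j s))
    where
    minor : Carrier → Fin (suc m) → Fin m → Fin m → Carrier
    minor x j r s = A x (suc r) (punchIn j s)

  IsPolynomial-prod : ∀ {k} (T : Carrier → Fin k → Carrier) → (∀ j → IsPolynomial 1 (λ x → T x j)) →
                      IsPolynomial k (λ x → prod (T x))
  IsPolynomial-prod {zero}  T p = IsPolynomial-const 0 1#
  IsPolynomial-prod {suc k} T p = IsPolynomial-* 1 k (p zero) (IsPolynomial-prod (λ x → T x ∘ suc) (p ∘ suc))

  -- The points 0 + 1, (0 + 1) + 1, …, built so that consecutive points differ by + 1#
  -- definitionally, which is the step of Δ.
  point : ℕ → Carrier
  point zero    = 0# + 1#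
  point (suc n) = point n + 1#

  point≉0 : ∀ n → point n ≉ 0#
  point≉0 n point≈0 = 0≉1 (≤-antisym 0≤1 (≤-respʳ-≈ point≈0 (1≤point n)))
    where
    1≤point : ∀ n → 1# ≤ point n
    1≤point zero    = ≤-reflexive (sym (+-identityˡ 1#))
    1≤point (suc n) = ≤-trans (1≤point n) (≤-respˡ-≈ (+-identityʳ _) (+-monoʳ-≤ (point n) 0≤1))

  -- r 0 = r (0 + 1) − Δ r 0, and Δ r again vanishes at all the points.
  vanishes-at-points⇒vanishes-at-0 : ∀ d {r} → IsPolynomial d r → (∀ n → r (point n) ≈ 0#) → r 0# ≈ 0#
  vanishes-at-points⇒vanishes-at-0 zero    p r≈0 = trans (p 0# (point 0)) (r≈0 0)
  vanishes-at-points⇒vanishes-at-0 (suc d) {r} p r≈0 = begin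
    r 0#                                ≈⟨ solve 2 (λ a b → b := a :- (a :- b)) refl (r (0# + 1#)) (r 0#) ⟩
    r (0# + 1#) - (r (0# + 1#) - r 0#)  ≈⟨ +-cong (r≈0 0) (-‿cong Δr0≈0) ⟩
    0# - 0#                             ≈⟨ -‿inverseʳ 0# ⟩
    0#                                  ∎
    where
    Δr0≈0 : Δ r 0# ≈ 0#
    Δr0≈0 = vanishes-at-points⇒vanishes-at-0 d p λ n → trans (+-cong (r≈0 (suc n)) (-‿cong (r≈0 n))) (-‿inverseʳ 0#)

  x*f≗x*g⇒f0≈g0 : ∀ d {f g} → IsPolynomial d f → IsPolynomial d g → (∀ x → x * f x ≈ x * g x) → f 0# ≈ g 0#
  x*f≗x*g⇒f0≈g0 d pf pg xf≈xg = x-y≈0⇒x≈y (vanishes-at-points⇒vanishes-at-0 d (IsPolynomial-sub d pf pg)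
    λ n → trans (+-congʳ (*-cancelˡ (point≉0 n) (xf≈xg (point n)))) (-‿inverseʳ _))

module CharacteristicPolynomial {c ℓ₁ ℓ₂} (F : OrderedField c ℓ₁ ℓ₂) where

  open import Data.Nat as ℕ using (ℕ; zero; suc)
  import Data.Nat.Properties as ℕ
  open import Data.Fin as Fin using (Fin; zero; suc; inject₁; fromℕ)
  open import Data.Fin.Properties using (_≟_; toℕ-inject₁; toℕ-fromℕ; toℕ<n)
  open import Data.Product using (Σ; _,_; proj₁; proj₂)
  open import Function using (_∘_)
  open import Relation.Binary.PropositionalEquality as ≡ using (_≡_; _≢_)
  open import Relation.Nullary using (yes; no; contradiction)

  open OrderedFieldProperties F
  open Linear F using (det; prod; charPoly; IsSortedEigenvalues)
  open Determinant F
  open LinearSystems F using (_*ᵥ_)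
  open Polynomial F

  scalarMatrix : ∀ {m} → Carrier → Matrix m m
  scalarMatrix x i j with i ≟ j
  ... | yes _ = x
  ... | no _  = 0#

  scalarMatrix-zero : ∀ {m} (i j : Fin m) → scalarMatrix 0# i j ≈ 0#
  scalarMatrix-zero i j with i ≟ j
  ... | yes _ = refl
  ... | no _  = refl

  -- charPoly keeps the matrix x I − M local to a where-block; unification recovers it,
  -- so that charPoly M x and det (charMatrix M x) agree definitionally.
  charPoly-as-det : ∀ {m} (M : Matrix m m) x → Σ (Matrix m m) λ C → charPoly M x ≡ det C
  charPoly-as-det M x = _ , ≡.refl

  charMatrix : ∀ {m} → Matrix m m → Carrier → Matrix m m
  charMatrix M x = proj₁ (charPoly-as-det M x)

  charMatrix-entry : ∀ {m} (M : Matrix m m) x i j → charMatrix M x i j ≈ scalarMatrix x i j - M i j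
  charMatrix-entry M x i j with i ≟ j
  ... | yes _ = refl
  ... | no _  = refl

  scalarMatrix-*ᵥ : ∀ {m} x (v : Fin m → Carrier) i → (scalarMatrix x *ᵥ v) i ≈ x * v i
  scalarMatrix-*ᵥ x v i = trans (sum-δ i off-diagonal) (*-congʳ (diagonal i))
    where
    diagonal : ∀ i → scalarMatrix x i i ≈ x
    diagonal i with i ≟ i
    ... | yes _  = refl
    ... | no i≢i = contradiction ≡.refl i≢i
    off-diagonal : ∀ l → l ≢ i → scalarMatrix x i l * v l ≈ 0#
    off-diagonal l l≢i with i ≟ l
    ... | yes i≡l = contradiction (≡.sym i≡l) l≢i
    ... | no _    = zeroˡ (v l)

  charMatrix-*ᵥ : ∀ {m} (M : Matrix m m) x (v : Fin m → Carrier) i → (charMatrix M x *ᵥ v) i ≈ x * v i - (M *ᵥ v) i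
  charMatrix-*ᵥ M x v i = begin
    sum (λ l → charMatrix M x i l * v l)
      ≈⟨ sum-cong-≋ (λ l → trans (*-congʳ (charMatrix-entry M x i l))
                                 (solve 3 (λ d a b → (d :- a) :* b := d :* b :- a :* b)
                                          refl (scalarMatrix x i l) (M i l) (v l))) ⟩
    sum (λ l → scalarMatrix x i l * v l - M i l * v l)
      ≈⟨ sum-sub (λ l → scalarMatrix x i l * v l) (λ l → M i l * v l) ⟩
    (scalarMatrix x *ᵥ v) i - (M *ᵥ v) i ≈⟨ +-congʳ (scalarMatrix-*ᵥ x v i) ⟩
    x * v i - (M *ᵥ v) i ∎

  IsPolynomial-scalarMatrix : ∀ {m} (i j : Fin m) → IsPolynomial 1 (λ x → scalarMatrix x i j)
  IsPolynomial-scalarMatrix i j with i ≟ j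
  ... | yes _ = IsPolynomial-id
  ... | no _  = IsPolynomial-const 1 0#

  IsPolynomial-charMatrix : ∀ {m} (M : Matrix m m) i j → IsPolynomial 1 (λ x → charMatrix M x i j)
  IsPolynomial-charMatrix M i j = IsPolynomial-cong 1 (λ x → sym (charMatrix-entry M x i j))
    (IsPolynomial-sub 1 (IsPolynomial-scalarMatrix i j) (IsPolynomial-const 1 (M i j)))

  IsPolynomial-replaceColumn : ∀ {m} (A : Carrier → Matrix m m) q (u : Fin m → Carrier) →
    (∀ i j → IsPolynomial 1 (λ x → A x i j)) → ∀ i j → IsPolynomial 1 (λ x → replaceColumn (A x) q u i j)
  IsPolynomial-replaceColumn A q u p i j with j ≟ q
  ... | yes ≡.refl = IsPolynomial-cong 1 (λ x → sym (replaceColumn-at (A x) j u i)) (IsPolynomial-const 1 (u i))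
  ... | no j≢q     = IsPolynomial-cong 1 (λ x → sym (replaceColumn-elsewhere (A x) q u i j≢q)) (p i j)

  prod-init-last : ∀ {m} (f : Fin (suc m) → Carrier) → prod f ≈ prod (f ∘ inject₁) * f (fromℕ m)
  prod-init-last {zero}  f = *-comm _ _
  prod-init-last {suc m} f = trans (*-congˡ (prod-init-last (f ∘ suc))) (sym (*-assoc _ _ _))

  prod≈0 : ∀ {m} (f : Fin m → Carrier) j → f j ≈ 0# → prod f ≈ 0#
  prod≈0 f zero    fⱼ≈0 = trans (*-congʳ fⱼ≈0) (zeroˡ _)
  prod≈0 f (suc j) fⱼ≈0 = trans (*-congˡ (prod≈0 (f ∘ suc) j fⱼ≈0)) (zeroʳ _)

  prod≉0 : ∀ {m} (f : Fin m → Carrier) → (∀ i → f i ≉ 0#) → prod f ≉ 0#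
  prod≉0 {zero}  f f≉0 = 0≉1 ∘ sym
  prod≉0 {suc m} f f≉0 = x≉0∧y≉0⇒x*y≉0 (f≉0 zero) (prod≉0 (f ∘ suc) (f≉0 ∘ suc))

  module SortedSpectrum {m} (M : Matrix (suc (suc m)) (suc (suc m))) (ν : Fin (suc (suc m)) → Carrier)
                        (sortedEigenvalues : IsSortedEigenvalues M ν) where

    charPoly≈prod : ∀ x → charPoly M x ≈ prod (λ i → x - ν i)
    charPoly≈prod = proj₁ sortedEigenvalues

    sorted : ∀ i j → i Fin.≤ j → ν j ≤ ν i
    sorted = proj₂ sortedEigenvalues

    penultimate last : Fin (suc (suc m))
    penultimate = inject₁ (fromℕ m)
    last        = fromℕ (suc m)

    withoutLastTwo withoutLast : Carrier → Carrier
    withoutLastTwo x = prod (λ i → x - ν (inject₁ (inject₁ i)))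
    withoutLast    x = withoutLastTwo x * (x - ν penultimate)

    IsPolynomial-withoutLastTwo : IsPolynomial m withoutLastTwo
    IsPolynomial-withoutLastTwo = IsPolynomial-prod (λ x i → x - ν (inject₁ (inject₁ i)))
      λ i → IsPolynomial-sub 1 IsPolynomial-id (IsPolynomial-const 1 (ν (inject₁ (inject₁ i))))

    IsPolynomial-withoutLast : IsPolynomial (m ℕ.+ 1) withoutLast
    IsPolynomial-withoutLast = IsPolynomial-* m 1 IsPolynomial-withoutLastTwo
      (IsPolynomial-sub 1 IsPolynomial-id (IsPolynomial-const 1 (ν penultimate)))

    charPoly-split : ∀ x → charPoly M x ≈ withoutLastTwo x * (x - ν penultimate) * (x - ν last)
    charPoly-split x = trans (charPoly≈prod x)
      (trans (prod-init-last (λ i → x - ν i)) (*-congʳ (prod-init-last (λ i → x - ν (inject₁ i)))))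

    eigenvalue-root : ∀ j → charPoly M (ν j) ≈ 0#
    eigenvalue-root j = trans (charPoly≈prod (ν j)) (prod≈0 (λ i → ν j - ν i) j (-‿inverseʳ (ν j)))

    ν-last≤ν-penultimate : ν last ≤ ν penultimate
    ν-last≤ν-penultimate = sorted penultimate last
      (≡.subst₂ ℕ._≤_ (≡.sym (≡.trans (toℕ-inject₁ (fromℕ m)) (toℕ-fromℕ m))) (≡.sym (toℕ-fromℕ (suc m)))
                      (ℕ.n≤1+n m))

    ν-penultimate≤ν-early : ∀ i → ν penultimate ≤ ν (inject₁ (inject₁ i))
    ν-penultimate≤ν-early i = sorted (inject₁ (inject₁ i)) penultimate
      (≡.subst₂ ℕ._≤_ (≡.sym (≡.trans (toℕ-inject₁ (inject₁ i)) (toℕ-inject₁ i)))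
                      (≡.sym (≡.trans (toℕ-inject₁ (fromℕ m)) (toℕ-fromℕ m))) (ℕ.<⇒≤ (toℕ<n i)))

    -- If νₖ₋₁ > 0 then all of ν₁, …, νₖ₋₁ are positive.
    withoutLast0≉0 : 0# ≤ ν penultimate → ν penultimate ≉ 0# → withoutLast 0# ≉ 0#
    withoutLast0≉0 0≤νₖ₋₁ νₖ₋₁≉0 =
      x≉0∧y≉0⇒x*y≉0 (prod≉0 _ early≉0) (νₖ₋₁≉0 ∘ sym ∘ x-y≈0⇒x≈y)
      where
      early≉0 : ∀ i → 0# - ν (inject₁ (inject₁ i)) ≉ 0#
      early≉0 i 0-νᵢ≈0 =
        νₖ₋₁≉0 (≤-antisym (≤-respʳ-≈ (sym (x-y≈0⇒x≈y 0-νᵢ≈0)) (ν-penultimate≤ν-early i)) 0≤νₖ₋₁)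

module Walks {k} (Adj : Fin k → Fin k → Set) (adj? : Decidable Adj) where

  open import Data.Nat as ℕ using (ℕ; zero; suc; z≤n; s≤s)
  open import Data.Fin using (zero; suc; inject₁; fromℕ)
  import Data.Nat.Properties as ℕ
  open import Data.Fin.Properties using (_≟_; any?; injective⇒≤)
  open import Data.Product using (Σ; _×_; _,_)
  open import Data.Unit using (⊤; tt)
  open import Function.Definitions using (Injective)
  open import Relation.Binary.Construct.Closure.ReflexiveTransitive using (Star; ε; _◅_)
  open import Relation.Binary.PropositionalEquality using (_≡_; _≢_; refl; sym; cong; subst)
  open import Relation.Nullary using (Dec; yes; no; contradiction)
  open import Relation.Nullary.Decidable using (_×-dec_)

  Walk : Fin k → Fin k → Set
  Walk = Star Adj

  Connected : Set
  Connected = ∀ i j → Walk i j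

  length : ∀ {i j} → Walk i j → ℕ
  length ε       = 0
  length (_ ◅ w) = suc (length w)

  vertex : ∀ {i j} (w : Walk i j) → Fin (suc (length w)) → Fin k
  vertex {i} ε       zero    = i
  vertex {i} (_ ◅ w) zero    = i
  vertex     (_ ◅ w) (suc t) = vertex w t

  vertex-first : ∀ {i j} (w : Walk i j) → vertex w zero ≡ i
  vertex-first ε       = refl
  vertex-first (_ ◅ w) = refl

  vertex-last : ∀ {i j} (w : Walk i j) → vertex w (fromℕ (length w)) ≡ j
  vertex-last ε       = refl
  vertex-last (_ ◅ w) = vertex-last w

  vertex-adjacent : ∀ {i j} (w : Walk i j) (t : Fin (length w)) → Adj (vertex w (inject₁ t)) (vertex w (suc t))
  vertex-adjacent (_◅_ {i} a w) zero    = subst (Adj i) (sym (vertex-first w)) a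
  vertex-adjacent (_ ◅ w)       (suc t) = vertex-adjacent w t

  IsPath : ∀ {i j} → Walk i j → Set
  IsPath ε             = ⊤
  IsPath (_◅_ {i} _ w) = (∀ t → vertex w t ≢ i) × IsPath w

  vertex-injective : ∀ {i j} (w : Walk i j) → IsPath w → Injective _≡_ _≡_ (vertex w)
  vertex-injective ε       _              {zero}  {zero}  _ = refl
  vertex-injective (_ ◅ w) _              {zero}  {zero}  _ = refl
  vertex-injective (_ ◅ w) (fresh , _)    {zero}  {suc t} e = contradiction (sym e) (fresh t)
  vertex-injective (_ ◅ w) (fresh , _)    {suc s} {zero}  e = contradiction e (fresh s)
  vertex-injective (_ ◅ w) (_ , path)     {suc s} {suc t} e = cong suc (vertex-injective w path e)

  path-length<k : ∀ {i j} (w : Walk i j) → IsPath w → length w ℕ.< k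
  path-length<k w path = injective⇒≤ (vertex-injective w path)

  Path : Fin k → Fin k → Set
  Path i j = Σ (Walk i j) IsPath

  suffix : ∀ {i j} (w : Walk i j) → IsPath w → (t : Fin (suc (length w))) → Path (vertex w t) j
  suffix ε       _            zero    = ε , tt
  suffix (a ◅ w) path         zero    = a ◅ w , path
  suffix (_ ◅ w) (_ , path)   (suc t) = suffix w path t

  -- Cut out the loop at the first vertex whenever it reappears.
  toPath : ∀ {i j} → Walk i j → Path i j
  toPath ε = ε , tt
  toPath {i} (a ◅ w) with toPath w
  ... | w′ , path with any? (λ t → vertex w′ t ≟ i)
  ...   | yes (t , vₜ≡i) = subst (λ x → Path x _) vₜ≡i (suffix w′ path t)
  ...   | no fresh       = a ◅ w′ , (λ t vₜ≡i → fresh (t , vₜ≡i)) , path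

  WalkWithin : ℕ → Fin k → Fin k → Set
  WalkWithin n i j = Σ (Walk i j) λ w → length w ℕ.≤ n

  walkWithin? : ∀ n i j → Dec (WalkWithin n i j)
  walkWithin? n i j with i ≟ j
  ... | yes refl = yes (ε , z≤n)
  walkWithin? zero    i j | no i≢j = no λ { (ε , _) → i≢j refl ; (_ ◅ _ , ()) }
  walkWithin? (suc n) i j | no i≢j with any? (λ l → adj? i l ×-dec walkWithin? n l j)
  ... | yes (l , a , w , len≤n) = yes (a ◅ w , s≤s len≤n)
  ... | no ∄l = no λ { (ε , _) → i≢j refl ; (_◅_ {j = l} a w , s≤s len≤n) → ∄l (l , a , w , len≤n) }

  walk? : ∀ i j → Dec (Walk i j)
  walk? i j with walkWithin? k i j
  ... | yes (w , _) = yes w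
  ... | no ∄w       = no λ w → let (p , path) = toPath w in ∄w (p , ℕ.<⇒≤ (path-length<k p path))

module Laplacian {c ℓ₁ ℓ₂} (F : OrderedField c ℓ₁ ℓ₂) {k} (Adj : Fin k → Fin k → Set) (adj? : Decidable Adj)
  where

  open import Level using (_⊔_)
  open import Relation.Binary.PropositionalEquality using (_≢_)

  open OrderedFieldProperties F
  open Determinant F using (Matrix)

  adjacency : Matrix k k
  adjacency i j = 𝟙 (adj? i j)

  degree : Fin k → Carrier
  degree i = sum (adjacency i)

  record IsLaplacian (L : Matrix k k) : Set (c ⊔ ℓ₁) where
    field
      diagonal    : ∀ i → L i i ≈ degree i
      offDiagonal : ∀ i j → i ≢ j → L i j ≈ - adjacency i j

module LaplacianSpectrum {c ℓ₁ ℓ₂} (F : OrderedField c ℓ₁ ℓ₂) {n} (Adj : Fin (suc n) → Fin (suc n) → Set)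
  (adj? : Decidable Adj) (adj-sym : Symmetric Adj) (adj-irrefl : ∀ {i} → ¬ Adj i i)
  {L} (isLaplacian : Laplacian.IsLaplacian F Adj adj? L) where

  open import Data.Fin using (zero; suc; punchIn)
  open import Data.Fin.Properties using (_≟_; ∀-cons; punchInᵢ≢i)
  open import Data.Product using (_,_; proj₁; proj₂)
  open import Data.Sum using (inj₁; inj₂)
  open import Function using (_∘_; const)
  open import Relation.Binary.Construct.Closure.ReflexiveTransitive using (ε; _◅_)
  import Relation.Binary.PropositionalEquality as ≡
  open import Relation.Nullary using (Dec; yes; no; contradiction)
  open import Relation.Nullary.Decidable using (¬?; ¬¬-excluded-middle)

  open OrderedFieldProperties F
  open Linear F using (det; charPoly)
  open Determinant F
  open LinearSystems F
  open Polynomial F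
  open CharacteristicPolynomial F
  open Walks Adj adj?
  open Laplacian F Adj adj?
  open IsLaplacian isLaplacian

  V : Set
  V = Fin (suc n)

  adjacency-*-vanishes : ∀ {i l} {x} → (Adj i l → x ≈ 0#) → adjacency i l * x ≈ 0#
  adjacency-*-vanishes {i} {l} {x} x≈0 with adj? i l
  ... | yes a = trans (*-identityˡ x) (x≈0 a)
  ... | no _  = zeroˡ x

  0≤adjacency : ∀ i l → 0# ≤ adjacency i l
  0≤adjacency i l with adj? i l
  ... | yes _ = 0≤1
  ... | no _  = ≤-refl

  adjacency≈1 : ∀ {i l} → Adj i l → adjacency i l ≈ 1#
  adjacency≈1 {i} {l} a with adj? i l
  ... | yes _ = refl
  ... | no ¬a = contradiction a ¬a

  L*ᵥ≈degree-adjacency : ∀ v i → (L *ᵥ v) i ≈ degree i * v i - (adjacency *ᵥ v) i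
  L*ᵥ≈degree-adjacency v i = begin
    (L *ᵥ v) i                          ≈⟨ sum-remove {i = i} (λ l → L i l * v l) ⟩
    L i i * v i + sum (λ s → L i (pᵢ s) * v (pᵢ s))
      ≈⟨ +-cong (*-congʳ (diagonal i)) (sum-cong-≋ off-diagonal) ⟩
    degree i * v i + sum (λ s → - (adjacency i (pᵢ s) * v (pᵢ s)))
      ≈⟨ +-congˡ (sum-neg (λ s → adjacency i (pᵢ s) * v (pᵢ s))) ⟩
    degree i * v i - sum (λ s → adjacency i (pᵢ s) * v (pᵢ s))
      ≈⟨ +-congˡ (-‿cong (trans (+-congʳ (adjacency-*-vanishes λ a → contradiction a adj-irrefl)) (+-identityˡ _))) ⟨
    degree i * v i - (adjacency i i * v i + sum (λ s → adjacency i (pᵢ s) * v (pᵢ s)))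
      ≈⟨ +-congˡ (-‿cong (sum-remove {i = i} (λ l → adjacency i l * v l))) ⟨
    degree i * v i - (adjacency *ᵥ v) i ∎
    where
    pᵢ : Fin n → V
    pᵢ = punchIn i
    off-diagonal : ∀ s → L i (pᵢ s) * v (pᵢ s) ≈ - (adjacency i (pᵢ s) * v (pᵢ s))
    off-diagonal s = trans (*-congʳ (offDiagonal i (pᵢ s) (punchInᵢ≢i i s ∘ ≡.sym)))
                           (sym (-‿distribˡ-* (adjacency i (pᵢ s)) (v (pᵢ s))))

  L*ᵥ≈Σdifferences : ∀ v i → (L *ᵥ v) i ≈ sum (λ l → adjacency i l * (v i - v l))
  L*ᵥ≈Σdifferences v i = begin
    (L *ᵥ v) i                                   ≈⟨ L*ᵥ≈degree-adjacency v i ⟩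
    degree i * v i - (adjacency *ᵥ v) i          ≈⟨ +-congʳ (*-distribʳ-sum (v i) (adjacency i)) ⟩
    sum (λ l → adjacency i l * v i) - (adjacency *ᵥ v) i
      ≈⟨ sum-sub (λ l → adjacency i l * v i) (λ l → adjacency i l * v l) ⟨
    sum (λ l → adjacency i l * v i - adjacency i l * v l)
      ≈⟨ sum-cong-≋ (λ l → solve 3 (λ a x y → a :* x :- a :* y := a :* (x :- y)) refl (adjacency i l) (v i) (v l)) ⟩
    sum (λ l → adjacency i l * (v i - v l))      ∎

  0≤L*ᵥ-at-maximum : ∀ v {a} → (∀ l → v l ≤ v a) → 0# ≤ (L *ᵥ v) a
  0≤L*ᵥ-at-maximum v {a} max = ≤-respʳ-≈ (sym (L*ᵥ≈Σdifferences v a))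
    (sum-nonNeg λ l → *-nonneg (0≤adjacency a l) (x≤y⇒0≤y-x (max l)))

  L*ᵥ≤0-at-minimum : ∀ v {b} → (∀ l → v b ≤ v l) → (L *ᵥ v) b ≤ 0#
  L*ᵥ≤0-at-minimum v {b} min =
    ≤-respˡ-≈ (sym L*ᵥ≈-Σ) (0≤x⇒-x≤0 (sum-nonNeg λ l → *-nonneg (0≤adjacency b l) (x≤y⇒0≤y-x (min l))))
    where
    L*ᵥ≈-Σ : (L *ᵥ v) b ≈ - sum (λ l → adjacency b l * (v l - v b))
    L*ᵥ≈-Σ = trans (L*ᵥ≈Σdifferences v b) (trans (sum-cong-≋ λ l →
      solve 3 (λ x a c → x :* (a :- c) := :- (x :* (c :- a))) refl (adjacency b l) (v b) (v l))
      (sum-neg (λ l → adjacency b l * (v l - v b))))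

  harmonic-at-maximum⇒neighbours-maximal : ∀ v {a} → (∀ l → v l ≤ v a) → (L *ᵥ v) a ≈ 0# →
                                           ∀ {l} → Adj a l → v l ≈ v a
  harmonic-at-maximum⇒neighbours-maximal v {a} max La≈0 {l} a~l = sym (x-y≈0⇒x≈y (begin
    v a - v l                     ≈⟨ *-identityˡ _ ⟨
    1# * (v a - v l)              ≈⟨ *-congʳ (adjacency≈1 a~l) ⟨
    adjacency a l * (v a - v l)   ≈⟨ sum-nonNeg≈0⇒≈0 (λ l → *-nonneg (0≤adjacency a l) (x≤y⇒0≤y-x (max l)))
                                                     (trans (sym (L*ᵥ≈Σdifferences v a)) La≈0) l ⟩
    0#                            ∎))

  connected-harmonic⇒constant : Connected → ∀ v → (∀ i → (L *ᵥ v) i ≈ 0#) → ∀ i j → v i ≈ v j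
  connected-harmonic⇒constant connected v Lv≈0 i j = trans (maximal (connected a i) refl) (sym (maximal (connected a j) refl))
    where
    a : V
    a = proj₁ (argmax v)
    max : ∀ l → v l ≤ v a
    max = proj₂ (argmax v)
    maximal : ∀ {x y} → Walk x y → v x ≈ v a → v y ≈ v a
    maximal ε         vx≈va = vx≈va
    maximal (x~l ◅ w) vx≈va = maximal w (trans (harmonic-at-maximum⇒neighbours-maximal v
      (λ l → ≤-respʳ-≈ (sym vx≈va) (max l)) (Lv≈0 _) x~l) vx≈va)

  -- At a maximum a, ν v_a = (L v)_a ≥ 0 forces v_a ≤ 0; symmetrically v ≥ 0 at a minimum.
  negative-eigenvector-vanishes : ∀ {ν} → ν ≤ 0# → ν ≉ 0# →
                                  ∀ v → (∀ i → (L *ᵥ v) i ≈ ν * v i) → ∀ j → v j ≈ 0#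
  negative-eigenvector-vanishes {ν} ν≤0 ν≉0 v eigen j = ≤-antisym (≤-trans (max j) vₐ≤0) (≤-trans 0≤v_b (min j))
    where
    a b : V
    a = proj₁ (argmax v)
    b = proj₁ (argmin v)
    max : ∀ l → v l ≤ v a
    max = proj₂ (argmax v)
    min : ∀ l → v b ≤ v l
    min = proj₂ (argmin v)
    vₐ≤0 : v a ≤ 0#
    vₐ≤0 with ≤-total (v a) 0#
    ... | inj₁ vₐ≤0 = vₐ≤0
    ... | inj₂ 0≤vₐ = ≤-reflexive (x*y≈0⇒y≈0 ν≉0 (≤-antisym νvₐ≤0 0≤νvₐ))
      where
      νvₐ≤0 : ν * v a ≤ 0#
      νvₐ≤0 = ≤-respʳ-≈ (zeroˡ (v a)) (*-monoˡ-≤-nonNeg (v a) 0≤vₐ ν≤0)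
      0≤νvₐ : 0# ≤ ν * v a
      0≤νvₐ = ≤-respʳ-≈ (eigen a) (0≤L*ᵥ-at-maximum v max)
    0≤v_b : 0# ≤ v b
    0≤v_b with ≤-total 0# (v b)
    ... | inj₁ 0≤v_b = 0≤v_b
    ... | inj₂ v_b≤0 = ≤-reflexive (sym (x*y≈0⇒y≈0 ν≉0 (≤-antisym νv_b≤0 0≤νv_b)))
      where
      νv_b≤0 : ν * v b ≤ 0#
      νv_b≤0 = ≤-respˡ-≈ (eigen b) (L*ᵥ≤0-at-minimum v min)
      0≤νv_b : 0# ≤ ν * v b
      0≤νv_b = ≤-respʳ-≈ (-x*-y≈x*y ν (v b)) (*-nonneg (x≤0⇒0≤-x ν≤0) (x≤0⇒0≤-x v_b≤0))

  eigenvalue-nonNeg : ∀ ν → charPoly L ν ≈ 0# → ¬ ¬ (0# ≤ ν)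
  eigenvalue-nonNeg ν charPoly≈0 ¬0≤ν with ≤-total 0# ν
  ... | inj₁ 0≤ν = ¬0≤ν 0≤ν
  ... | inj₂ ν≤0 = ¬¬-excluded-middle {A = ν ≈ 0#} λ where
      (yes ν≈0) → ¬0≤ν (≤-reflexive (sym ν≈0))
      (no ν≉0)  → det≈0⇒¬¬kernel (charMatrix L ν) charPoly≈0 λ (v , (j , vⱼ≉0) , Cv≈0) →
        vⱼ≉0 (negative-eigenvector-vanishes ν≤0 ν≉0 v (eigen v Cv≈0) j)
    where
    eigen : ∀ v → (∀ i → (charMatrix L ν *ᵥ v) i ≈ 0#) → ∀ i → (L *ᵥ v) i ≈ ν * v i
    eigen v Cv≈0 i = sym (x-y≈0⇒x≈y (trans (sym (charMatrix-*ᵥ L ν v i)) (Cv≈0 i)))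

  IsLocallyConstant : (V → Carrier) → Set ℓ₁
  IsLocallyConstant u = ∀ {i l} → Adj i l → u i ≈ u l

  locallyConstant⇒harmonic : ∀ {u} → IsLocallyConstant u → ∀ i → (L *ᵥ u) i ≈ 0#
  locallyConstant⇒harmonic {u} u-const i = trans (L*ᵥ≈Σdifferences u i)
    (sum-zero λ l → adjacency-*-vanishes {i} {l} λ i~l → trans (+-congʳ (u-const i~l)) (-‿inverseʳ (u l)))

  locallyConstant-eigenvector : ∀ {u} → IsLocallyConstant u → ∀ x i → sum (λ l → u l * charMatrix L x i l) ≈ x * u i
  locallyConstant-eigenvector {u} u-const x i = begin
    sum (λ l → u l * charMatrix L x i l)  ≈⟨ sum-cong-≋ (λ l → *-comm (u l) (charMatrix L x i l)) ⟩
    (charMatrix L x *ᵥ u) i               ≈⟨ charMatrix-*ᵥ L x u i ⟩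
    x * u i - (L *ᵥ u) i                  ≈⟨ y≈0⇒x-y≈x (x * u i) (locallyConstant⇒harmonic u-const i) ⟩
    x * u i                               ∎

  charPoly-factor : ∀ {u} → IsLocallyConstant u → ∀ {q} → u q ≈ 1# →
                    ∀ x → charPoly L x ≈ x * det (replaceColumn (charMatrix L x) q u)
  charPoly-factor {u} u-const {q} u_q≈1 x =
    det-factor-eigenvalue (charMatrix L x) q u x u_q≈1 (locallyConstant-eigenvector u-const x)

  indicator : ∀ {P : V → Set} → (∀ i → Dec (P i)) → V → Carrier
  indicator P? i = 𝟙 (P? i)

  module _ {P : V → Set} (P? : ∀ i → Dec (P i)) where

    indicator-∈ : ∀ {i} → P i → indicator P? i ≈ 1#
    indicator-∈ {i} Pi with P? i
    ... | yes _  = refl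
    ... | no ¬Pi = contradiction Pi ¬Pi

    indicator-∉ : ∀ {i} → ¬ P i → indicator P? i ≈ 0#
    indicator-∉ {i} ¬Pi with P? i
    ... | yes Pi = contradiction Pi ¬Pi
    ... | no _   = refl

  indicator-locallyConstant : ∀ {P : V → Set} (P? : ∀ i → Dec (P i)) → (∀ {i l} → Adj i l → P i → P l) →
                              IsLocallyConstant (indicator P?)
  indicator-locallyConstant P? closed {i} {l} i~l with P? i | P? l
  ... | yes _  | yes _  = refl
  ... | no _   | no _   = refl
  ... | yes Pi | no ¬Pl = contradiction (closed i~l Pi) ¬Pl
  ... | no ¬Pi | yes Pl = contradiction (closed (adj-sym i~l) Pl) ¬Pi

  reducedDet : Carrier → Carrier
  reducedDet x = det (replaceColumn (charMatrix L x) zero (const 1#))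

  IsPolynomial-reducedDet : IsPolynomial (suc n) reducedDet
  IsPolynomial-reducedDet = IsPolynomial-det (suc n) _
    (IsPolynomial-replaceColumn (charMatrix L) zero (const 1#) (IsPolynomial-charMatrix L))

  charPoly≈x*reducedDet : ∀ x → charPoly L x ≈ x * reducedDet x
  charPoly≈x*reducedDet = charPoly-factor {const 1#} (λ _ → refl) {zero} refl

  -- A kernel vector v of the reduced matrix gives L w = v₀ · 1 for w = v with w₀ := 0;
  -- the maximum principle forces v₀ = 0, connectivity then makes w constant, hence 0.
  connected⇒reducedDet0≉0 : Connected → reducedDet 0# ≉ 0#
  connected⇒reducedDet0≉0 connected det≈0 = det≈0⇒¬¬kernel N det≈0 λ (v , (j , vⱼ≉0) , Nv≈0) →
    vⱼ≉0 (vanishes v Nv≈0 j)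
    where
    N : Matrix (suc n) (suc n)
    N = replaceColumn (charMatrix L 0#) zero (const 1#)
    vanishes : ∀ v → (∀ i → (N *ᵥ v) i ≈ 0#) → ∀ j → v j ≈ 0#
    vanishes v Nv≈0 = ∀-cons v₀≈0 (λ s → constant (suc s) zero)
      where
      w : V → Carrier
      w zero    = 0#
      w (suc s) = v (suc s)
      R : V → Carrier
      R i = sum (λ s → L i (suc s) * v (suc s))
      Lw≈R : ∀ i → (L *ᵥ w) i ≈ R i
      Lw≈R i = trans (+-congʳ (zeroʳ (L i zero))) (+-identityˡ (R i))
      Nv≈v₀-R : ∀ i → (N *ᵥ v) i ≈ v zero - R i
      Nv≈v₀-R i = +-cong (trans (*-congʳ (replaceColumn-at (charMatrix L 0#) zero (const 1#) i)) (*-identityˡ (v zero)))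
        (trans (sum-cong-≋ λ s → trans (*-congʳ (N≈-L s)) (sym (-‿distribˡ-* _ _))) (sum-neg (λ s → L i (suc s) * v (suc s))))
        where
        N≈-L : ∀ s → N i (suc s) ≈ - L i (suc s)
        N≈-L s = begin
          N i (suc s)                              ≈⟨ replaceColumn-elsewhere (charMatrix L 0#) zero (const 1#) i (λ ()) ⟩
          charMatrix L 0# i (suc s)                ≈⟨ charMatrix-entry L 0# i (suc s) ⟩
          scalarMatrix 0# i (suc s) - L i (suc s)  ≈⟨ +-congʳ (scalarMatrix-zero i (suc s)) ⟩
          0# - L i (suc s)                         ≈⟨ +-identityˡ _ ⟩
          - L i (suc s)                            ∎
      Lw≈v₀ : ∀ i → (L *ᵥ w) i ≈ v zero
      Lw≈v₀ i = trans (Lw≈R i) (sym (x-y≈0⇒x≈y (trans (sym (Nv≈v₀-R i)) (Nv≈0 i))))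
      v₀≈0 : v zero ≈ 0#
      v₀≈0 = ≤-antisym (≤-respˡ-≈ (Lw≈v₀ b) (L*ᵥ≤0-at-minimum w (proj₂ (argmin w))))
                       (≤-respʳ-≈ (Lw≈v₀ a) (0≤L*ᵥ-at-maximum w (proj₂ (argmax w))))
        where
        a b : V
        a = proj₁ (argmax w)
        b = proj₁ (argmin w)
      constant : ∀ i j → w i ≈ w j
      constant = connected-harmonic⇒constant connected w λ i → trans (Lw≈v₀ i) v₀≈0

  module _ {C : V → Set} (C? : ∀ i → Dec (C i)) (closed : ∀ {i l} → Adj i l → C i → C l)
           {p q} (p∈C : C p) (q∉C : ¬ C q) where

    private
      uC uD : V → Carrier
      uC = indicator C?
      uD = indicator (¬? ∘ C?)

      uD-locallyConstant : IsLocallyConstant uD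
      uD-locallyConstant = indicator-locallyConstant (¬? ∘ C?) λ i~l ¬Ci Cl → ¬Ci (closed (adj-sym i~l) Cl)

    cutDet : Carrier → Carrier
    cutDet x = det (replaceColumn (replaceColumn (charMatrix L x) p uC) q uD)

    IsPolynomial-cutDet : IsPolynomial (suc n) cutDet
    IsPolynomial-cutDet = IsPolynomial-det (suc n) _
      (IsPolynomial-replaceColumn _ q uD (IsPolynomial-replaceColumn (charMatrix L) p uC (IsPolynomial-charMatrix L)))

    -- The indicators of the cut side and of its complement are independent eigenvectors
    -- for x, so x² divides the characteristic polynomial.
    charPoly≈x*x*cutDet : ∀ x → charPoly L x ≈ x * (x * cutDet x)
    charPoly≈x*x*cutDet x = trans (charPoly-factor (indicator-locallyConstant C? closed) (indicator-∈ C? p∈C) x)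
      (*-congˡ (det-factor-eigenvalue B q uD x (indicator-∈ (¬? ∘ C?) q∉C) λ i →
        trans (sum-cong-≋ (column-p-irrelevant i)) (locallyConstant-eigenvector uD-locallyConstant x i)))
      where
      B : Matrix (suc n) (suc n)
      B = replaceColumn (charMatrix L x) p uC
      column-p-irrelevant : ∀ i l → uD l * B i l ≈ uD l * charMatrix L x i l
      column-p-irrelevant i l with l ≟ p
      ... | yes ≡.refl = trans (*-congʳ uD-p≈0) (trans (zeroˡ _) (sym (trans (*-congʳ uD-p≈0) (zeroˡ _))))
        where
        uD-p≈0 : uD l ≈ 0#
        uD-p≈0 = indicator-∉ (¬? ∘ C?) λ ¬Cp → ¬Cp p∈C
      ... | no l≢p     = *-congˡ (replaceColumn-elsewhere (charMatrix L x) p uC i l≢p)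

module LaplacianConnectivity {c ℓ₁ ℓ₂} (F : OrderedField c ℓ₁ ℓ₂) {m}
  (Adj : Fin (suc (suc m)) → Fin (suc (suc m)) → Set) (adj? : Decidable Adj) (adj-sym : Symmetric Adj) (adj-irrefl : ∀ {i} → ¬ Adj i i)
  {L} (isLaplacian : Laplacian.IsLaplacian F Adj adj? L)
  {ν} (sortedEigenvalues : Linear.IsSortedEigenvalues F L ν) where

  import Data.Nat.Properties as ℕ
  open import Function using (id)
  open import Relation.Binary.Construct.Closure.ReflexiveTransitive using (ε; _◅_; _◅◅_)
  open import Relation.Nullary using (Dec; yes; no; contradiction)

  open OrderedFieldProperties F
  open Linear F using (charPoly)
  open Polynomial F
  open CharacteristicPolynomial F
  open SortedSpectrum L ν sortedEigenvalues
  open Walks Adj adj?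
  open LaplacianSpectrum F Adj adj? adj-sym adj-irrefl isLaplacian

  -- If νₖ₋₁ = 0 then also νₖ = 0, so x² divides charPoly = x · reducedDet; hence
  -- reducedDet 0 = 0, which connectivity forbids.
  connected⇒ν-penultimate≉0 : Connected → ν penultimate ≉ 0#
  connected⇒ν-penultimate≉0 connected νₖ₋₁≈0 = eigenvalue-nonNeg (ν last) (eigenvalue-root last) λ 0≤νₖ →
    connected⇒reducedDet0≉0 connected
      (reducedDet0≈0 (≤-antisym (≤-respʳ-≈ νₖ₋₁≈0 ν-last≤ν-penultimate) 0≤νₖ))
    where
    reducedDet0≈0 : ν last ≈ 0# → reducedDet 0# ≈ 0#
    reducedDet0≈0 νₖ≈0 = trans (x*f≗x*g⇒f0≈g0 (suc (suc m)) {reducedDet} {λ x → x * withoutLastTwo x}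
        IsPolynomial-reducedDet
        (IsPolynomial-mono (ℕ.n≤1+n (suc m)) (IsPolynomial-* 1 m IsPolynomial-id IsPolynomial-withoutLastTwo))
        λ x → begin
          x * reducedDet x                                      ≈⟨ charPoly≈x*reducedDet x ⟨
          charPoly L x                                          ≈⟨ charPoly-split x ⟩
          withoutLastTwo x * (x - ν penultimate) * (x - ν last)
            ≈⟨ *-cong (*-congˡ (y≈0⇒x-y≈x x νₖ₋₁≈0)) (y≈0⇒x-y≈x x νₖ≈0) ⟩
          withoutLastTwo x * x * x
            ≈⟨ solve 2 (λ p x → p :* x :* x := x :* (x :* p)) refl (withoutLastTwo x) x ⟩
          x * (x * withoutLastTwo x)                            ∎)
      (zeroˡ (withoutLastTwo 0#))

  -- A cut gives x² ∣ charPoly, so 0 is at least a double root: if νₖ₋₁ were nonzero,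
  -- it would be positive and only νₖ could vanish.
  cut⇒¬ν-penultimate≉0 : ∀ {C : Fin (suc (suc m)) → Set} (C? : ∀ i → Dec (C i)) →
                         (∀ {i l} → Adj i l → C i → C l) → ∀ {p q} → C p → ¬ C q → ¬ (ν penultimate ≉ 0#)
  cut⇒¬ν-penultimate≉0 C? closed p∈C q∉C νₖ₋₁≉0 =
    eigenvalue-nonNeg (ν penultimate) (eigenvalue-root penultimate) λ 0≤νₖ₋₁ →
      withoutLast0≉0 0≤νₖ₋₁ νₖ₋₁≉0 (withoutLast0≈0 (νₖ≈0 0≤νₖ₋₁))
    where
    Q : Carrier → Carrier
    Q = cutDet C? closed p∈C q∉C
    νₖ≈0 : 0# ≤ ν penultimate → ν last ≈ 0#
    νₖ≈0 0≤νₖ₋₁ = sym (x-y≈0⇒x≈y (x*y≈0⇒y≈0 (withoutLast0≉0 0≤νₖ₋₁ νₖ₋₁≉0)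
      (trans (sym (charPoly-split 0#)) (trans (charPoly≈x*x*cutDet C? closed p∈C q∉C 0#) (zeroˡ _)))))
    withoutLast0≈0 : ν last ≈ 0# → withoutLast 0# ≈ 0#
    withoutLast0≈0 νₖ≈0 = trans (x*f≗x*g⇒f0≈g0 (suc (suc (suc m))) {withoutLast} {λ x → x * Q x}
        (IsPolynomial-mono (ℕ.m≤n⇒m≤1+n (ℕ.m≤n⇒m≤1+n (ℕ.≤-reflexive (ℕ.+-comm m 1)))) IsPolynomial-withoutLast)
        (IsPolynomial-* 1 (suc (suc m)) {id} {Q} IsPolynomial-id (IsPolynomial-cutDet C? closed p∈C q∉C))
        λ x → begin
          x * withoutLast x              ≈⟨ *-comm x (withoutLast x) ⟩
          withoutLast x * x              ≈⟨ *-congˡ (y≈0⇒x-y≈x x νₖ≈0) ⟨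
          withoutLast x * (x - ν last)   ≈⟨ charPoly-split x ⟨
          charPoly L x                   ≈⟨ charPoly≈x*x*cutDet C? closed p∈C q∉C x ⟩
          x * (x * Q x)                  ∎)
      (zeroˡ (Q 0#))

  ν-penultimate≉0⇒connected : ν penultimate ≉ 0# → Connected
  ν-penultimate≉0⇒connected νₖ₋₁≉0 i j with walk? i j
  ... | yes w = w
  ... | no ¬w = contradiction νₖ₋₁≉0 (cut⇒¬ν-penultimate≉0 (walk? i) (λ a w → w ◅◅ (a ◅ ε)) ε ¬w)

module Enumeration where

  open import Data.Nat using (zero; suc)
  open import Data.Fin using (zero; suc)
  open import Data.Fin.Subset using (Subset; inside; outside)
  open import Data.List using (List; map; lookup)
  open import Data.List.Relation.Unary.Any using (here)
  import Data.List.Relation.Unary.All as All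
  import Data.List.Relation.Unary.AllPairs as AllPairs
  open import Data.List.Relation.Unary.Unique.Propositional using (Unique)
  import Data.List.Relation.Unary.Unique.Propositional.Properties as Unique
  open import Data.List.Membership.Propositional using (_∈_)
  open import Data.List.Membership.Propositional.Properties using (∈-map⁺; ∈-map⁻; ∈-++⁺ˡ; ∈-++⁺ʳ; ∈-lookup)
  open import Data.Product using (_×_; _,_)
  open import Data.Vec using ([]; _∷_)
  import Data.Vec.Properties as Vec
  open import Relation.Binary.PropositionalEquality using (_≡_; refl; sym; cong)
  open import Relation.Nullary using (¬_; contradiction)

  allSubsets-complete : ∀ m (S : Subset m) → S ∈ allSubsets m
  allSubsets-complete zero    []            = here refl
  allSubsets-complete (suc m) (inside ∷ S)  = ∈-++⁺ˡ (∈-map⁺ (inside ∷_) (allSubsets-complete m S))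
  allSubsets-complete (suc m) (outside ∷ S) =
    ∈-++⁺ʳ (map (inside ∷_) (allSubsets m)) (∈-map⁺ (outside ∷_) (allSubsets-complete m S))

  allSubsets-unique : ∀ m → Unique (allSubsets m)
  allSubsets-unique zero    = All.[] AllPairs.∷ AllPairs.[]
  allSubsets-unique (suc m) = Unique.++⁺ (Unique.map⁺ Vec.∷-injectiveʳ (allSubsets-unique m))
                                         (Unique.map⁺ Vec.∷-injectiveʳ (allSubsets-unique m)) disjoint
    where
    disjoint : ∀ {S} → ¬ (S ∈ map (inside ∷_) (allSubsets m) × S ∈ map (outside ∷_) (allSubsets m))
    disjoint (S∈ins , S∈outs) with ∈-map⁻ (inside ∷_) S∈ins | ∈-map⁻ (outside ∷_) S∈outs
    ... | _ , _ , refl | _ , _ , ()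

  lookup-injective : ∀ {A : Set} {xs : List A} → Unique xs → ∀ {i j} → lookup xs i ≡ lookup xs j → i ≡ j
  lookup-injective (_ AllPairs.∷ _)      {zero}  {zero}  _ = refl
  lookup-injective (x∉xs AllPairs.∷ _)   {zero}  {suc j} e = contradiction e (All.lookup x∉xs (∈-lookup j))
  lookup-injective (x∉xs AllPairs.∷ _)   {suc i} {zero}  e = contradiction (sym e) (All.lookup x∉xs (∈-lookup i))
  lookup-injective (_ AllPairs.∷ unique) {suc i} {suc j} e = cong suc (lookup-injective unique e)

module PartitionGraph (H : Hypergraph) where

  open import Data.Nat using (ℕ; zero; suc)
  open import Data.Fin using (Fin; zero; suc; inject₁; fromℕ)
  open import Data.Fin.Properties using (_≟_)
  open import Data.Fin.Subset using (Subset; _∈_)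
  open import Data.Fin.Subset.Properties using (∪-comm; ∩-comm; ∩-idem; ∉⊥)
  import Data.List.Relation.Unary.Any as Any
  open import Data.List.Relation.Unary.Any.Properties using (lookup-index)
  import Data.List.Relation.Unary.All as All
  open import Data.List.Relation.Unary.All.Properties using (all-filter)
  import Data.List.Relation.Unary.Unique.Propositional.Properties as Unique
  open import Data.List.Membership.Propositional using () renaming (_∈_ to _∈ₗ_)
  open import Data.List.Membership.Propositional.Properties using (∈-filter⁺; ∈-lookup)
  open import Data.Product using (Σ; _,_; proj₁; proj₂)
  open import Data.Sum using (inj₂)
  open import Function using (_∘_; _⇔_; mk⇔)
  open import Relation.Binary.Construct.Closure.ReflexiveTransitive using (ε; _◅_)
  open import Relation.Binary.PropositionalEquality using (_≡_; refl; sym; trans; cong; subst; subst₂)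
  open import Relation.Nullary using (¬_; Dec; yes; no)

  k : ℕ
  k = eIndex H

  _∼_ : Fin k → Fin k → Set
  i ∼ j = Sim H (elemI H i) (elemI H j)

  _∼?_ : ∀ i j → Dec (i ∼ j)
  i ∼? j = ∼-dec H (elemI H i) (elemI H j)

  open Walks _∼_ _∼?_ public
  open Enumeration using (allSubsets-complete; allSubsets-unique; lookup-injective)

  Sim-sym : ∀ {S S′} → Sim H S S′ → Sim H S′ S
  Sim-sym {S} {S′} (S∪S′∈E , S∩S′≡⊥ , S≠∅ , S′≠∅) =
    Any.map (trans (∪-comm S′ S)) S∪S′∈E , trans (∩-comm S′ S) S∩S′≡⊥ , S′≠∅ , S≠∅

  Sim-irrefl : ∀ {S} → ¬ Sim H S S
  Sim-irrefl {S} (_ , S∩S≡⊥ , (x , x∈S) , _) = ∉⊥ (subst (x ∈_) (trans (sym (∩-idem S)) S∩S≡⊥) x∈S)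

  elemI-injective : ∀ {i j} → elemI H i ≡ elemI H j → i ≡ j
  elemI-injective = lookup-injective (Unique.filter⁺ (InI-dec H) (allSubsets-unique (n H)))

  elemI∈I : ∀ i → InI H (elemI H i)
  elemI∈I i = All.lookup (all-filter (InI-dec H) (allSubsets (n H))) (∈-lookup i)

  index : ∀ {S} → InI H S → Σ (Fin k) λ i → elemI H i ≡ S
  index {S} S∈I = Any.index S∈Ilist , sym (lookup-index S∈Ilist)
    where
    S∈Ilist : S ∈ₗ Ilist H
    S∈Ilist = ∈-filter⁺ (InI-dec H) (allSubsets-complete (n H) S) S∈I

  exactPath⇒walk : ∀ m (S : Fin (suc m) → Subset (n H)) → (∀ (t : Fin m) → Sim H (S (inject₁ t)) (S (suc t))) →
                   ∀ {i j} → elemI H i ≡ S zero → elemI H j ≡ S (fromℕ m) → Walk i j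
  exactPath⇒walk zero    S _     {i} {j} i≡S₀ j≡S₀ with elemI-injective (trans i≡S₀ (sym j≡S₀))
  ... | refl = ε
  exactPath⇒walk (suc m) S steps {i} i≡S₀ j≡Sₘ = i∼l ◅ exactPath⇒walk m (S ∘ suc) (steps ∘ suc) l≡S₁ j≡Sₘ
    where
    l : Fin k
    l = proj₁ (index (inj₂ (S zero , Sim-sym (steps zero))))
    l≡S₁ : elemI H l ≡ S (suc zero)
    l≡S₁ = proj₂ (index (inj₂ (S zero , Sim-sym (steps zero))))
    i∼l : i ∼ l
    i∼l = subst₂ (Sim H) (sym i≡S₀) (sym l≡S₁) (steps zero)

  path⇒exactPath : ∀ {i j} (w : Walk i j) → IsPath w → ExactPath H (elemI H i) (elemI H j)
  path⇒exactPath w path = length w , elemI H ∘ vertex w , cong (elemI H) (vertex-first w) , cong (elemI H) (vertex-last w) ,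
                          vertex-injective w path ∘ elemI-injective , vertex-adjacent w

  connected⇔deeplyConnected : Connected ⇔ DeeplyConnected H
  connected⇔deeplyConnected = mk⇔ connected⇒deeplyConnected deeplyConnected⇒connected
    where
    deeplyConnected⇒connected : DeeplyConnected H → Connected
    deeplyConnected⇒connected dc i j with i ≟ j
    ... | yes refl = ε
    ... | no i≢j with dc (elemI H i) (elemI H j) (elemI∈I i) (elemI∈I j) (i≢j ∘ elemI-injective)
    ...   | m , S , S₀≡ , Sₘ≡ , _ , steps = exactPath⇒walk m S steps (sym S₀≡) (sym Sₘ≡)
    connected⇒deeplyConnected : Connected → DeeplyConnected H
    connected⇒deeplyConnected connected A B A∈I B∈I _ with index A∈I | index B∈I
    ... | i , refl | j , refl = let w , path = toPath (connected i j) in path⇒exactPath w path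

module PartitionLaplacian {c ℓ₁ ℓ₂} (F : OrderedField c ℓ₁ ℓ₂) (H : Hypergraph) where

  open import Data.Fin.Properties using (_≟_)
  open import Data.List using (List; []; _∷_; filter; length; lookup)
  open import Relation.Binary.PropositionalEquality as ≡ using (_≢_)
  open import Relation.Nullary using (Dec; yes; no; contradiction)

  open OrderedFieldProperties F
  open Linear F using (ofℕ; UL)
  open PartitionGraph H using (_∼_; _∼?_)
  open Laplacian F _∼_ _∼?_

  ofℕ-length-filter : ∀ {A : Set} {P : A → Set} (P? : ∀ x → Dec (P x)) (xs : List A) →
                      ofℕ (length (filter P? xs)) ≈ sum (λ j → 𝟙 (P? (lookup xs j)))
  ofℕ-length-filter P? []       = refl
  ofℕ-length-filter P? (x ∷ xs) with P? x
  ... | yes _ = +-congˡ (ofℕ-length-filter P? xs)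
  ... | no _  = trans (ofℕ-length-filter P? xs) (sym (+-identityˡ _))

  UL-isLaplacian : IsLaplacian (UL H)
  UL-isLaplacian = record { diagonal = diagonal ; offDiagonal = offDiagonal }
    where
    diagonal : ∀ i → UL H i i ≈ degree i
    diagonal i with i ≟ i
    ... | yes _  = ofℕ-length-filter (∼-dec H (elemI H i)) (Ilist H)
    ... | no i≢i = contradiction ≡.refl i≢i
    offDiagonal : ∀ i j → i ≢ j → UL H i j ≈ - adjacency i j
    offDiagonal i j i≢j with i ≟ j
    ... | yes i≡j = contradiction i≡j i≢j
    ... | no _ with i ∼? j
    ...   | yes _ = refl
    ...   | no _  = sym ε⁻¹≈ε

open import Data.Nat using (_≤_; s≤s; z≤n)
open import Function using (_⇔_; mk⇔)
open import Function.Construct.Composition using (_⇔-∘_)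

penultimateEigenvalue≉0⇔connected : ∀ {c ℓ₁ ℓ₂} (F : OrderedField c ℓ₁ ℓ₂) {k} (hk : 2 ≤ k)
  (Adj : Fin k → Fin k → Set) (adj? : Decidable Adj) → Symmetric Adj → (∀ {i} → ¬ Adj i i) →
  ∀ {L} → Laplacian.IsLaplacian F Adj adj? L → ∀ ν → Linear.IsSortedEigenvalues F L ν →
  (¬ (OrderedField._≈_ F (ν (secondLast hk)) (OrderedField.0# F))) ⇔ Walks.Connected Adj adj?
penultimateEigenvalue≉0⇔connected F (s≤s (s≤s z≤n)) Adj adj? adj-sym adj-irrefl isLaplacian ν sortedEigenvalues =
  mk⇔ ν-penultimate≉0⇒connected connected⇒ν-penultimate≉0
  where open LaplacianConnectivity F Adj adj? adj-sym adj-irrefl isLaplacian sortedEigenvalues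

mainTheorem7 : ∀ {c ℓ₁ ℓ₂} (F : OrderedField c ℓ₁ ℓ₂) (H : Hypergraph) → IsSimple H →
    (hk : 2 ≤ eIndex H) →
    (ν : Fin (eIndex H) → OrderedField.Carrier F) →
    Linear.IsSortedEigenvalues F (Linear.UL F H) ν →
    (¬ (OrderedField._≈_ F (ν (secondLast hk)) (OrderedField.0# F))) ⇔ DeeplyConnected H
mainTheorem7 F H _ hk ν sortedEigenvalues =
  connected⇔deeplyConnected ⇔-∘
  penultimateEigenvalue≉0⇔connected F hk _∼_ _∼?_ Sim-sym Sim-irrefl (UL-isLaplacian F H) ν sortedEigenvalues
  where
  open PartitionGraph H using (_∼_; _∼?_; Sim-sym; Sim-irrefl; connected⇔deeplyConnected)
  open PartitionLaplacian using (UL-isLaplacian)
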